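{- Let $k\ge4$ and let $H$ be the $k$-th power of the Hamilton cycle on $[n]$. Let $F\subset H$ be a graph without isolated vertices and without isolated edges, and let $\mathcal D(F)$ be a consistent partition of $V(F)$. Then $$Y_F(H)\le [n]_{c(F)}\,(4k)^{|\mathcal D(F)|}.$$
   Context: $H$ has vertex set $[n]$ and edges $\{v,v+i\}$ for $v\in[n]$, $i\in[k]$ (addition modulo $n$); $n$ is sufficiently large; $H_s$ is the subgraph of $H$ induced by $[s]$. An isolated edge is an edge forming a whole connected component. $c(F)$ is the number of connected components of $F$ and $[n]_c=n(n-1)\cdots(n-c+1)$ is the falling factorial. $Y_F(G)$ is the number of embeddings of $F$ into $G$, i.e. injections $\iota:V(F)\to V(G)$ with $\{\iota(u),\iota(v)\}\in E(G)$ for all $\{u,v\}\in E(F)$. A partition $\mathcal D(F)$ of $V(F)$ is consistent if for every part $D$, $F[D]$ is isomorphic to $H_s$ for some $s\in\{1\}\cup\{2k+1,\dots,n\}$. -}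

module Defs where

open import Data.Nat using (ℕ; zero; suc; _+_; _*_; _≤_; _≡ᵇ_; NonZero)
open import Data.Nat.DivMod using (_%_)
open import Data.Fin using (Fin; toℕ; _≟_)
open import Data.Fin.Base using (inject≤)
open import Data.Bool using (Bool; true; false; _∧_; _∨_; not)
open import Data.List using (List; []; _∷_; map; concatMap; filter; length; allFin; foldr; upTo)
open import Data.Bool using (T?)
open import Data.Vec.Functional using (Vector)
open import Data.Product using (Σ; ∃; _×_)
open import Data.Sum using (_⊎_)
open import Relation.Binary.PropositionalEquality using (_≡_)
open import Relation.Nullary using (¬_)
open import Relation.Nullary.Decidable using (⌊_⌋)

allL : ∀ {A : Set} → (A → Bool) → List A → Bool
allL p = foldr (λ x r → p x ∧ r) true

anyL : ∀ {A : Set} → (A → Bool) → List A → Bool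
anyL p = foldr (λ x r → p x ∨ r) false

adjH : ∀ {n} → ℕ → Fin n → Fin n → Bool
adjH {zero} k ()
adjH {suc n} k u v =
  not ⌊ u ≟ v ⌋ ∧
  anyL (λ j → let i = suc j in
         (((toℕ u + i) % suc n) ≡ᵇ toℕ v) ∨ (((toℕ v + i) % suc n) ≡ᵇ toℕ u))
      (upTo k)

record Graph (m : ℕ) : Set where
  field
    adj   : Fin m → Fin m → Bool
    sym   : ∀ a b → adj a b ≡ adj b a
    irref : ∀ a → adj a a ≡ false
open Graph public

allMaps : (m n : ℕ) → List (Fin m → Fin n)
allMaps zero    n = (λ ()) ∷ []
allMaps (suc m) n =
  concatMap (λ x → map (λ f → λ { Fin.zero → x ; (Fin.suc a) → f a }) (allMaps m n)) (allFin n)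

isEmbeddingᵇ : ∀ {m n} → ℕ → Graph m → (Fin m → Fin n) → Bool
isEmbeddingᵇ {m} k F f =
  allL (λ a → allL (λ b →
        (⌊ a ≟ b ⌋ ∨ not ⌊ f a ≟ f b ⌋) ∧ (not (adj F a b) ∨ adjH k (f a) (f b)))
      (allFin m)) (allFin m)

Y : ∀ {m} → (n k : ℕ) → Graph m → ℕ
Y {m} n k F = length (filter (λ f → T? (isEmbeddingᵇ k F f)) (allMaps m n))

walk : ∀ {m} → Graph m → ℕ → Fin m → Fin m → Bool
walk F zero    a b = ⌊ a ≟ b ⌋
walk {m} F (suc t) a b = walk F t a b ∨ anyL (λ w → walk F t a w ∧ adj F w b) (allFin m)

-- a and b lie in the same connected component (walks of length ≤ m suffice)
connectedᵇ : ∀ {m} → Graph m → Fin m → Fin m → Bool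
connectedᵇ {m} F a b = walk F m a b

-- c(F): number of components = number of vertices that are the least
-- vertex (in the order of Fin m) of their component.
isLeastInComponent : ∀ {m} → Graph m → Fin m → Bool
isLeastInComponent {m} F a =
  allL (λ b → not (⌊ Data.Fin._<?_ b a ⌋ ∧ connectedᵇ F b a)) (allFin m)

c : ∀ {m} → Graph m → ℕ
c {m} F = length (filter (λ a → T? (isLeastInComponent F a)) (allFin m))

-- F ⊂ H : F is (isomorphic to) a subgraph of H, i.e. F embeds into H
SubgraphOfH : ∀ {m} → (n k : ℕ) → Graph m → Set
SubgraphOfH {m} n k F =
  Σ (Fin m → Fin n) λ f →
    (∀ a b → f a ≡ f b → a ≡ b) × (∀ a b → adj F a b ≡ true → adjH k (f a) (f b) ≡ true)

NoIsolatedVertices : ∀ {m} → Graph m → Set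
NoIsolatedVertices {m} F = ∀ (a : Fin m) → ∃ λ b → adj F a b ≡ true

NoIsolatedEdges : ∀ {m} → Graph m → Set
NoIsolatedEdges {m} F =
  ∀ (a b : Fin m) → adj F a b ≡ true →
    ¬ ((∀ w → adj F a w ≡ true → w ≡ b) × (∀ w → adj F b w ≡ true → w ≡ a))

-- H_s: subgraph of H induced by [s] = {0,…,s-1}; F[D] ≅ H_s for the part
-- D = p⁻¹(j) of a partition given by a labelling p : Fin m → Fin d.
PartIsoHs : ∀ {m d} → (n k : ℕ) → Graph m → (Fin m → Fin d) → Fin d → (s : ℕ) → s ≤ n → Set
PartIsoHs {m} n k F p j s s≤n =
  Σ (Fin s → Fin m) λ g →
    (∀ x y → g x ≡ g y → x ≡ y) ×
    (∀ x → p (g x) ≡ j) ×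
    (∀ v → p v ≡ j → ∃ λ x → g x ≡ v) ×
    (∀ x y → adj F (g x) (g y) ≡ adjH k (inject≤ x s≤n) (inject≤ y s≤n))

-- A partition of V(F) into d (nonempty) parts, given as a surjective labelling,
-- is consistent if every part induces a copy of H_s, s ∈ {1} ∪ {2k+1,…,n}.
IsPartition : ∀ {m d} → (Fin m → Fin d) → Set
IsPartition {m} {d} p = ∀ (j : Fin d) → ∃ λ a → p a ≡ j

Consistent : ∀ {m d} → (n k : ℕ) → Graph m → (Fin m → Fin d) → Set
Consistent {m} {d} n k F p =
  ∀ (j : Fin d) → Σ ℕ λ s → Σ (s ≤ n) λ s≤n →
    (s ≡ 1 ⊎ 2 * k + 1 ≤ s) × PartIsoHs n k F p j s s≤n

-- An embedding f of F into H is determined by a code: the images of the least vertices of the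
-- components of F, an injective sequence of length c(F), and for each part of the partition one
-- letter from an alphabet of 4k letters, namely the signed offset in ±{1,…,k} from a neighbour of
-- lower breadth-first level to the part's lowest vertex, together with an orientation bit. Codes
-- are decoded level by level: a singleton part is fixed by its lowest vertex, and a part H_s with
-- s ≥ 2k+1 is rigid. Indeed, for n > k² + k the image of H_s, lifted to ℤ along the path
-- 0, 1, …, s−1, is an injective sequence whose values at distance at most k differ by at most k,
-- and such a sequence moves in unit steps of constant sign; so the orientation bit and the image
-- of one vertex determine the whole part. Hence Y_F(H) is at most the number of codes,
-- [n]_{c(F)} (4k)^{|D(F)|}.

module Submission where

open import Defs
open import Data.Nat using (ℕ; _≤_; _*_; _^_)
open import Data.Nat.Combinatorics using (_P_)
open import Data.Fin using (Fin)
open import Data.Product using (Σ; ∃; _×_)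

open import Data.Nat.Base using (zero; suc; _+_; _∸_; _<_; z≤n; s≤s; _≤ᵇ_; _≡ᵇ_; NonZero; >-nonZero; >-nonZero⁻¹)
import Data.Nat.Properties as ℕ
open import Data.Nat.Combinatorics.Base using (_P′_)
open import Data.Nat.DivMod using (_%_; _/_; _mod_; m≡m%n+[m/n]*n; m<n⇒m%n≡m)
open import Data.Fin.Base using (toℕ; inject≤)
import Data.Fin as Fin
import Data.Fin.Properties as Fin
open import Data.Integer.Base as ℤ
  using (ℤ; +_; ∣_∣; +≤+; +<+)
  renaming (_+_ to _+ℤ_; _-_ to _-ℤ_; _*_ to _*ℤ_; -_ to -ℤ_; _≤_ to _≤ℤ_; _<_ to _<ℤ_)
import Data.Integer.Properties as ℤ
open import Data.Integer.Tactic.RingSolver using (solve-∀)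
open import Data.Bool.Base using (Bool; true; false; _∧_; _∨_; not; T; if_then_else_)
open import Data.Bool.Properties as Bool using (T-≡; ∨-zeroʳ; ∧-conicalˡ; ∧-conicalʳ)
open import Data.List.Base
  using (List; []; _∷_; map; filter; length; allFin; upTo; applyUpTo; _++_; concatMap; cartesianProductWith; cartesianProduct)
open import Data.List.Properties as List
  using (length-map; length-++; length-upTo; length-applyUpTo; length-tabulate; filter-notAll; ∷-injectiveˡ; ∷-injectiveʳ)
open import Data.List.Membership.Propositional using (_∈_; _∉_)
open import Data.List.Membership.Propositional.Properties
  using ( ∈-filter⁺; ∈-filter⁻; ∈-map⁺; ∈-map⁻; ∈-concat⁺′; ∈-concat⁻′; ∈-allFin; ∈-upTo⁺; ∈-upTo⁻
        ; ∈-++⁺ˡ; ∈-++⁺ʳ; ∈-++⁻; ∈-cartesianProductWith⁺; ∈-cartesianProduct⁺)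
import Data.List.Membership.DecPropositional as DecMembership
open import Data.List.Relation.Binary.Subset.Propositional using (_⊆_)
open import Data.List.Relation.Unary.Any as Any using (here; there)
open import Data.List.Relation.Unary.All as All using (All; []; _∷_)
import Data.List.Relation.Unary.All.Properties as All
open import Data.List.Relation.Unary.AllPairs as AllPairs using (AllPairs; []; _∷_)
import Data.List.Relation.Unary.AllPairs.Properties as AllPairs
open import Data.List.Relation.Unary.Unique.Propositional using (Unique)
import Data.List.Relation.Unary.Unique.Propositional.Properties as Unique
import Data.List.Extrema as Extrema
open import Data.Product using (_,_; proj₁; proj₂)
import Data.Product.Properties as Product
open import Data.Sum using (_⊎_; inj₁; inj₂; [_,_]′)
open import Data.Empty using (⊥; ⊥-elim)
open import Function using (_∘_; id; Equivalence)
open import Level using (0ℓ)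
open import Relation.Binary.Bundles using (Setoid)
open import Relation.Binary.Definitions using (DecidableEquality)
open import Relation.Binary.PropositionalEquality
  using (_≡_; _≢_; _≗_; refl; trans; cong; cong₂; subst; subst₂; module ≡-Reasoning)
import Relation.Binary.PropositionalEquality as ≡
import Relation.Binary.Reasoning.Setoid as SetoidReasoning
open import Relation.Nullary using (¬_; Dec; yes; no; contradiction)
open import Relation.Nullary.Decidable using (¬?; ⌊_⌋; T?; dec-false; isYes≗does)

private
  variable
    A B C : Set

∨-true⁻ : ∀ {a b} → a ∨ b ≡ true → a ≡ true ⊎ b ≡ true
∨-true⁻ {true}  _   = inj₁ refl
∨-true⁻ {false} b≡t = inj₂ b≡t

∨-trueˡ : ∀ {a} b → a ≡ true → a ∨ b ≡ true
∨-trueˡ b refl = refl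

∨-trueʳ : ∀ a {b} → b ≡ true → a ∨ b ≡ true
∨-trueʳ a refl = ∨-zeroʳ a

∧-true : ∀ {a b} → a ≡ true → b ≡ true → a ∧ b ≡ true
∧-true refl refl = refl

not-false⁻ : ∀ {a} → not a ≡ false → a ≡ true
not-false⁻ {true} _ = refl

⌊⌋-true⁻ : ∀ {P : Set} (p? : Dec P) → ⌊ p? ⌋ ≡ true → P
⌊⌋-true⁻ (yes p) _ = p

⌊⌋-true⁺ : ∀ {P : Set} (p? : Dec P) → P → ⌊ p? ⌋ ≡ true
⌊⌋-true⁺ (yes _) _ = refl
⌊⌋-true⁺ (no ¬p) p = contradiction p ¬p

anyL⁺ : (p : A → Bool) {x : A} {xs : List A} → x ∈ xs → p x ≡ true → anyL p xs ≡ true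
anyL⁺ p {xs = _ ∷ xs} (here refl) px = ∨-trueˡ (anyL p xs) px
anyL⁺ p {xs = y ∷ _}  (there x∈xs) px = ∨-trueʳ (p y) (anyL⁺ p x∈xs px)

anyL⁻ : (p : A → Bool) (xs : List A) → anyL p xs ≡ true → ∃ λ x → x ∈ xs × p x ≡ true
anyL⁻ p (x ∷ xs) h with ∨-true⁻ {p x} h
... | inj₁ px = x , here refl , px
... | inj₂ rest with y , y∈xs , py ← anyL⁻ p xs rest = y , there y∈xs , py

allL⁻ : (p : A → Bool) {x : A} {xs : List A} → allL p xs ≡ true → x ∈ xs → p x ≡ true
allL⁻ p h (here refl) = ∧-conicalˡ _ _ h
allL⁻ p {xs = y ∷ _} h (there x∈xs) = allL⁻ p (∧-conicalʳ (p y) _ h) x∈xs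

allL-false⁻ : (p : A → Bool) (xs : List A) → allL p xs ≡ false → ∃ λ x → x ∈ xs × p x ≡ false
allL-false⁻ p (x ∷ xs) h with p x in px
... | false = x , here refl , px
... | true with y , y∈xs , py ← allL-false⁻ p xs h = y , there y∈xs , py

map≡map⇒≡ : (f g : A → B) {xs : List A} {x : A} → map f xs ≡ map g xs → x ∈ xs → f x ≡ g x
map≡map⇒≡ f g eq (here refl) = ∷-injectiveˡ eq
map≡map⇒≡ f g eq (there x∈xs) = map≡map⇒≡ f g (∷-injectiveʳ eq) x∈xs

Unique⇒length≤ : DecidableEquality A → {xs ys : List A} → Unique xs → xs ⊆ ys → length xs ≤ length ys
Unique⇒length≤ _≟_ {[]} _ _ = z≤n
Unique⇒length≤ _≟_ {x ∷ xs} {ys} (x∉xs ∷ !xs) xs⊆ys =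
  ℕ.≤-trans (s≤s (Unique⇒length≤ _≟_ !xs xs⊆ys-x))
            (filter-notAll x≢? ys (Any.map (λ x≡y x≢y → x≢y x≡y) (xs⊆ys (here refl))))
  where
  x≢? = λ y → ¬? (x ≟ y)
  xs⊆ys-x : xs ⊆ filter x≢? ys
  xs⊆ys-x z∈xs = ∈-filter⁺ x≢? (xs⊆ys (there z∈xs)) (All.lookup x∉xs z∈xs)

Unique-map⁺ : (E : A → B) {Q : A → Set} {R : A → A → Set} {xs : List A} → All Q xs → AllPairs R xs →
              (∀ {x y} → Q x → Q y → R x y → E x ≢ E y) → Unique (map E xs)
Unique-map⁺ E [] [] _ = []
Unique-map⁺ E {Q} {R} {x ∷ _} (qx ∷ qxs) (rxs ∷ !xs) separates =
  All.map⁺ (separated qxs rxs) ∷ Unique-map⁺ E qxs !xs separates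
  where
  separated : ∀ {ys} → All Q ys → All (R x) ys → All (λ y → E x ≢ E y) ys
  separated [] [] = []
  separated (qy ∷ qys) (r ∷ rs) = separates qx qy r ∷ separated qys rs

length-concatMap≤ : (f : A → List B) {K : ℕ} (xs : List A) → (∀ {x} → x ∈ xs → length (f x) ≤ K) →
                    length (concatMap f xs) ≤ K * length xs
length-concatMap≤ f [] _ = z≤n
length-concatMap≤ f {K} (x ∷ xs) bound = begin
  length (f x ++ concatMap f xs)        ≡⟨ length-++ (f x) ⟩
  length (f x) + length (concatMap f xs) ≤⟨ ℕ.+-mono-≤ (bound (here refl)) (length-concatMap≤ f xs (bound ∘ there)) ⟩
  K + K * length xs                      ≡⟨ ℕ.*-suc K (length xs) ⟨
  K * suc (length xs)                    ∎
  where open ℕ.≤-Reasoning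

length-cartesianProductWith : (f : A → B → C) (xs : List A) (ys : List B) →
                              length (cartesianProductWith f xs ys) ≡ length xs * length ys
length-cartesianProductWith f [] ys = refl
length-cartesianProductWith f (x ∷ xs) ys = begin
  length (map (f x) ys ++ cartesianProductWith f xs ys)       ≡⟨ length-++ (map (f x) ys) ⟩
  length (map (f x) ys) + length (cartesianProductWith f xs ys) ≡⟨ cong₂ _+_ (length-map (f x) ys) (length-cartesianProductWith f xs ys) ⟩
  length ys + length xs * length ys                            ∎
  where open ≡-Reasoning

words : List A → ℕ → List (List A)
words alphabet zero    = [] ∷ []
words alphabet (suc d) = cartesianProductWith _∷_ alphabet (words alphabet d)

∈-words : {alphabet : List A} (w : List A) → All (_∈ alphabet) w → w ∈ words alphabet (length w)
∈-words []      []              = here refl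
∈-words (x ∷ w) (x∈ ∷ w∈) = ∈-cartesianProductWith⁺ _∷_ x∈ (∈-words w w∈)

length-words : (alphabet : List A) (d : ℕ) → length (words alphabet d) ≡ length alphabet ^ d
length-words alphabet zero    = refl
length-words alphabet (suc d) =
  trans (length-cartesianProductWith _∷_ alphabet (words alphabet d)) (cong (length alphabet *_) (length-words alphabet d))

length-allFin : ∀ n → length (allFin n) ≡ n
length-allFin n = length-tabulate id

module InjectiveLists (n : ℕ) where
  open DecMembership (Fin._≟_ {n}) using (_∉?_)

  extensions : List (Fin n) → List (List (Fin n))
  extensions xs = map (_∷ xs) (filter (_∉? xs) (allFin n))

  injectiveLists : ℕ → List (List (Fin n))
  injectiveLists zero    = [] ∷ []
  injectiveLists (suc c) = concatMap extensions (injectiveLists c)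

  ∈-injectiveLists : (xs : List (Fin n)) → Unique xs → xs ∈ injectiveLists (length xs)
  ∈-injectiveLists []       _            = here refl
  ∈-injectiveLists (x ∷ xs) (x∉xs ∷ !xs) =
    ∈-concat⁺′ (∈-map⁺ (_∷ xs) (∈-filter⁺ (_∉? xs) (∈-allFin x) x∉xs′)) (∈-map⁺ extensions (∈-injectiveLists xs !xs))
    where
    x∉xs′ : x ∉ xs
    x∉xs′ x∈xs = All.lookup x∉xs x∈xs refl

  injectiveLists⁻ : ∀ c {xs} → xs ∈ injectiveLists c → Unique xs × length xs ≡ c
  injectiveLists⁻ zero (here refl) = [] , refl
  injectiveLists⁻ (suc c) xs∈
    with ys , xs∈ext , ys∈ext ← ∈-concat⁻′ (map extensions (injectiveLists c)) xs∈
    with zs , zs∈ , refl ← ∈-map⁻ extensions ys∈ext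
    with x , x∈ , refl ← ∈-map⁻ (_∷ zs) xs∈ext
    with !zs , refl ← injectiveLists⁻ c zs∈ =
    All.tabulate (λ { x∈zs refl → x∉zs x∈zs }) ∷ !zs , refl
    where
    x∉zs : x ∉ zs
    x∉zs = proj₂ (∈-filter⁻ (_∉? zs) {xs = allFin n} x∈)

  length-extensions : {xs : List (Fin n)} → Unique xs → length (extensions xs) ≤ n ∸ length xs
  length-extensions {xs} !xs = begin
    length (extensions xs)  ≡⟨ length-map (_∷ xs) fresh ⟩
    length fresh            ≤⟨ ℕ.m+n≤o⇒m≤o∸n (length fresh) (begin
      length fresh + length xs ≡⟨ length-++ fresh ⟨
      length (fresh ++ xs)     ≤⟨ Unique⇒length≤ Fin._≟_ !fresh++xs (λ _ → ∈-allFin _) ⟩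
      length (allFin n)        ≡⟨ length-allFin n ⟩
      n                        ∎) ⟩
    n ∸ length xs           ∎
    where
    open ℕ.≤-Reasoning
    fresh = filter (_∉? xs) (allFin n)
    !fresh++xs : Unique (fresh ++ xs)
    !fresh++xs = Unique.++⁺ (Unique.filter⁺ (_∉? xs) (Unique.allFin⁺ n)) !xs
                            (λ (x∈fresh , x∈xs) → proj₂ (∈-filter⁻ (_∉? xs) {xs = allFin n} x∈fresh) x∈xs)

  length-injectiveLists : ∀ c → length (injectiveLists c) ≤ n P′ c
  length-injectiveLists zero    = ℕ.≤-refl
  length-injectiveLists (suc c) = begin
    length (concatMap extensions (injectiveLists c)) ≤⟨ length-concatMap≤ extensions (injectiveLists c) bound ⟩
    (n ∸ c) * length (injectiveLists c)              ≤⟨ ℕ.*-monoʳ-≤ (n ∸ c) (length-injectiveLists c) ⟩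
    (n ∸ c) * (n P′ c)                               ∎
    where
    open ℕ.≤-Reasoning
    bound : ∀ {xs} → xs ∈ injectiveLists c → length (extensions xs) ≤ n ∸ c
    bound xs∈ with !xs , refl ← injectiveLists⁻ c xs∈ = length-extensions !xs

nPk≡nP′k : ∀ {n c} → c ≤ n → n P c ≡ n P′ c
nPk≡nP′k {n} {c} c≤n with c ≤ᵇ n | ℕ.≤⇒≤ᵇ c≤n
... | true | _ = refl

Distinct : ∀ {m n} → (Fin m → Fin n) → (Fin m → Fin n) → Set
Distinct f g = ¬ f ≗ g

-- allMaps builds each map from its head and tail by an anonymous pattern lambda, which is
-- therefore abstracted here by its two defining equations.
prepend-distinct : ∀ {m n} (cons : Fin n → (Fin m → Fin n) → Fin (suc m) → Fin n) →
                   (∀ x f → cons x f Fin.zero ≡ x) → (∀ x f i → cons x f (Fin.suc i) ≡ f i) →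
                   ∀ {fs} → AllPairs Distinct fs → AllPairs Distinct (concatMap (λ x → map (cons x) fs) (allFin n))
prepend-distinct {n = n} cons cons-zero cons-suc !fs =
  AllPairs.concat⁺ (All.map⁺ (All.tabulate λ _ → AllPairs.map⁺ (AllPairs.map differ-on-tail !fs)))
                   (AllPairs.map⁺ (AllPairs.map differ-on-head (Unique.allFin⁺ n)))
  where
  differ-on-tail : ∀ {x f g} → Distinct f g → Distinct (cons x f) (cons x g)
  differ-on-tail {x} {f} {g} f≉g x∷f≗x∷g =
    f≉g λ i → trans (≡.sym (cons-suc x f i)) (trans (x∷f≗x∷g (Fin.suc i)) (cons-suc x g i))
  differ-on-head : ∀ {x y fs′} → x ≢ y → All (λ h → All (Distinct h) (map (cons y) fs′)) (map (cons x) fs′)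
  differ-on-head {x} {y} x≢y = All.map⁺ (All.tabulate λ {f} _ → All.map⁺ (All.tabulate λ {g} _ x∷f≗y∷g →
    x≢y (trans (≡.sym (cons-zero x f)) (trans (x∷f≗y∷g Fin.zero) (cons-zero y g)))))

allMaps-distinct : ∀ m n → AllPairs Distinct (allMaps m n)
allMaps-distinct zero    n = [] ∷ []
allMaps-distinct (suc m) n = prepend-distinct _ (λ _ _ → refl) (λ _ _ _ → refl) (allMaps-distinct m n)

module Modulo (n : ℕ) where

  infix 4 _≡ₘ_
  record _≡ₘ_ (a b : ℤ) : Set where
    constructor with-quotient
    field
      quotient : ℤ
      equation : a ≡ b +ℤ quotient *ℤ + n

  ≡⇒≡ₘ : ∀ {a b} → a ≡ b → a ≡ₘ b
  ≡⇒≡ₘ {a} refl = with-quotient (+ 0) (lemma a (+ n))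
    where
    lemma : ∀ a n → a ≡ a +ℤ + 0 *ℤ n
    lemma = solve-∀

  ≡ₘ-refl : ∀ {a} → a ≡ₘ a
  ≡ₘ-refl = ≡⇒≡ₘ refl

  ≡ₘ-sym : ∀ {a b} → a ≡ₘ b → b ≡ₘ a
  ≡ₘ-sym {a} {b} (with-quotient q refl) = with-quotient (-ℤ q) (lemma b q (+ n))
    where
    lemma : ∀ b q n → b ≡ b +ℤ q *ℤ n +ℤ (-ℤ q) *ℤ n
    lemma = solve-∀

  ≡ₘ-trans : ∀ {a b c} → a ≡ₘ b → b ≡ₘ c → a ≡ₘ c
  ≡ₘ-trans {c = c} (with-quotient q refl) (with-quotient r refl) = with-quotient (r +ℤ q) (lemma c r q (+ n))
    where
    lemma : ∀ c r q n → c +ℤ r *ℤ n +ℤ q *ℤ n ≡ c +ℤ (r +ℤ q) *ℤ n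
    lemma = solve-∀

  ≡ₘ-setoid : Setoid 0ℓ 0ℓ
  ≡ₘ-setoid = record { _≈_ = _≡ₘ_ ; isEquivalence = record { refl = ≡ₘ-refl ; sym = ≡ₘ-sym ; trans = ≡ₘ-trans } }

  +-cong-≡ₘ : ∀ {a b c d} → a ≡ₘ b → c ≡ₘ d → a +ℤ c ≡ₘ b +ℤ d
  +-cong-≡ₘ {b = b} {d = d} (with-quotient q refl) (with-quotient r refl) = with-quotient (q +ℤ r) (lemma b d q r (+ n))
    where
    lemma : ∀ b d q r n → b +ℤ q *ℤ n +ℤ (d +ℤ r *ℤ n) ≡ b +ℤ d +ℤ (q +ℤ r) *ℤ n
    lemma = solve-∀

  +-cancelˡ-≡ₘ : ∀ c {a b} → c +ℤ a ≡ₘ c +ℤ b → a ≡ₘ b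
  +-cancelˡ-≡ₘ c {a} {b} (with-quotient q eq) = with-quotient q (begin
    a                            ≡⟨ lemma c a ⟩
    -ℤ c +ℤ (c +ℤ a)             ≡⟨ cong (-ℤ c +ℤ_) eq ⟩
    -ℤ c +ℤ (c +ℤ b +ℤ q *ℤ + n) ≡⟨ lemma′ c b (q *ℤ + n) ⟩
    b +ℤ q *ℤ + n                ∎)
    where
    open ≡-Reasoning
    lemma : ∀ c a → a ≡ -ℤ c +ℤ (c +ℤ a)
    lemma = solve-∀
    lemma′ : ∀ c b x → -ℤ c +ℤ (c +ℤ b +ℤ x) ≡ b +ℤ x
    lemma′ = solve-∀

  +-cancelʳ-≡ₘ : ∀ c {a b} → a +ℤ c ≡ₘ b +ℤ c → a ≡ₘ b
  +-cancelʳ-≡ₘ c {a} {b} a+c≡ₘb+c =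
    +-cancelˡ-≡ₘ c (≡ₘ-trans (≡⇒≡ₘ (ℤ.+-comm c a)) (≡ₘ-trans a+c≡ₘb+c (≡⇒≡ₘ (ℤ.+-comm b c))))

  ≡ₘ∧∣-∣<⇒≡ : ∀ {a b} → a ≡ₘ b → ∣ a -ℤ b ∣ < n → a ≡ b
  ≡ₘ∧∣-∣<⇒≡ {b = b} (with-quotient q refl) ∣a-b∣<n = trans (cong (λ q → b +ℤ q *ℤ + n) q≡0) (ℤ.+-identityʳ b)
    where
    lemma : ∀ b x → b +ℤ x -ℤ b ≡ x
    lemma = solve-∀
    ∣a-b∣≡ : ∣ b +ℤ q *ℤ + n -ℤ b ∣ ≡ ∣ q ∣ * n
    ∣a-b∣≡ = trans (cong ∣_∣ (lemma b (q *ℤ + n))) (ℤ.abs-* q (+ n))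
    q≡0 : q ≡ + 0
    q≡0 = ℤ.∣i∣≡0⇒i≡0 (ℕ.n<1⇒n≡0 (ℕ.*-cancelʳ-< n ∣ q ∣ 1
            (subst (_< 1 * n) ∣a-b∣≡ (subst (∣ b +ℤ q *ℤ + n -ℤ b ∣ <_) (≡.sym (ℕ.*-identityˡ n)) ∣a-b∣<n))))

  toℕ-≡ₘ-injective : {u v : Fin n} → + toℕ u ≡ₘ + toℕ v → u ≡ v
  toℕ-≡ₘ-injective {u} {v} u≡ₘv = Fin.toℕ-injective (ℤ.+-injective (≡ₘ∧∣-∣<⇒≡ u≡ₘv ∣u-v∣<n))
    where
    ∣u-v∣<n : ∣ + toℕ u -ℤ + toℕ v ∣ < n
    ∣u-v∣<n = subst (_< n) (cong ∣_∣ (≡.sym (ℤ.[+m]-[+n]≡m⊖n (toℕ u) (toℕ v))))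
                (ℕ.≤-<-trans (ℤ.∣m⊝n∣≤m⊔n (toℕ u) (toℕ v)) (ℕ.⊔-lub (Fin.toℕ<n u) (Fin.toℕ<n v)))

  %⇒≡ₘ : ∀ {a i b} .{{_ : NonZero n}} → (a + i) % n ≡ b → + b ≡ₘ + a +ℤ + i
  %⇒≡ₘ {a} {i} {b} refl = with-quotient (-ℤ + q) (begin
    + ((a + i) % n)                                ≡⟨ lemma (+ ((a + i) % n)) (+ q) (+ n) ⟩
    + ((a + i) % n) +ℤ + q *ℤ + n +ℤ -ℤ + q *ℤ + n ≡⟨ cong (λ x → x +ℤ -ℤ + q *ℤ + n) division ⟩
    + a +ℤ + i +ℤ -ℤ + q *ℤ + n                     ∎)
    where
    open ≡-Reasoning
    q = (a + i) / n
    lemma : ∀ r q n → r ≡ r +ℤ q *ℤ n +ℤ -ℤ q *ℤ n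
    lemma = solve-∀
    division : + ((a + i) % n) +ℤ + q *ℤ + n ≡ + a +ℤ + i
    division = ≡.sym (trans (cong +_ (m≡m%n+[m/n]*n (a + i) n)) (cong (+ ((a + i) % n) +ℤ_) (ℤ.pos-* q n)))

-- Injective integer sequences whose values at distance at most k are within k

Close : ℕ → ℤ → ℤ → Set
Close k a b = a ≤ℤ b +ℤ + k × b ≤ℤ a +ℤ + k

close-sym : ∀ {k a b} → Close k a b → Close k b a
close-sym (a≤ , b≤) = b≤ , a≤

close-refl : ∀ {k a} → Close k a a
close-refl {k} {a} = ℤ.i≤i+j a (+ k) , ℤ.i≤i+j a (+ k)

close-neg : ∀ {k a b} → Close k a b → Close k (-ℤ a) (-ℤ b)
close-neg {k} {a} {b} (a≤b+k , b≤a+k) = flip b≤a+k , flip a≤b+k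
  where
  open ℤ.≤-Reasoning
  lemma : ∀ a k → -ℤ a ≡ -ℤ (a +ℤ k) +ℤ k
  lemma = solve-∀
  flip : ∀ {a b} → b ≤ℤ a +ℤ + k → -ℤ a ≤ℤ -ℤ b +ℤ + k
  flip {a} {b} b≤a+k = begin
    -ℤ a                     ≡⟨ lemma a (+ k) ⟩
    -ℤ (a +ℤ + k) +ℤ + k     ≤⟨ ℤ.+-monoˡ-≤ (+ k) (ℤ.neg-mono-≤ b≤a+k) ⟩
    -ℤ b +ℤ + k              ∎

close-pairwise : ∀ {k xs v w} → AllPairs (Close k) xs → v ∈ xs → w ∈ xs → Close k v w
close-pairwise (_  ∷ _)  (here refl) (here refl) = close-refl
close-pairwise (cx ∷ _)  (here refl) (there w∈)  = All.lookup cx w∈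
close-pairwise (cx ∷ _)  (there v∈)  (here refl) = close-sym (All.lookup cx v∈)
close-pairwise (_  ∷ cs) (there v∈)  (there w∈)  = close-pairwise cs v∈ w∈

i≤j+k⇒i-k≤j : ∀ {i j k} → i ≤ℤ j +ℤ k → i -ℤ k ≤ℤ j
i≤j+k⇒i-k≤j {i} {j} {k} i≤j+k = begin
  i -ℤ k       ≤⟨ ℤ.+-monoˡ-≤ (-ℤ k) i≤j+k ⟩
  j +ℤ k -ℤ k  ≡⟨ lemma j k ⟩
  j            ∎
  where
  open ℤ.≤-Reasoning
  lemma : ∀ j k → j +ℤ k -ℤ k ≡ j
  lemma = solve-∀

interval-pigeonhole : ∀ {xs} lo r → Unique xs → All (λ v → lo ≤ℤ v × v <ℤ lo +ℤ + r) xs → length xs ≤ r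
interval-pigeonhole {xs} lo r !xs bounds =
  ℕ.≤-trans (Unique⇒length≤ ℤ._≟_ !xs xs⊆interval)
            (ℕ.≤-reflexive (trans (length-map (λ i → lo +ℤ + i) (upTo r)) (length-upTo r)))
  where
  interval = map (λ i → lo +ℤ + i) (upTo r)
  xs⊆interval : ∀ {v} → v ∈ xs → v ∈ interval
  xs⊆interval {v} v∈xs = subst (_∈ interval) lo+d≡v (∈-map⁺ (λ i → lo +ℤ + i) (∈-upTo⁺ d<r))
    where
    lemma₁ : ∀ lo v → lo +ℤ (v -ℤ lo) ≡ v
    lemma₁ = solve-∀
    lemma₂ : ∀ lo r → lo +ℤ r -ℤ lo ≡ r
    lemma₂ = solve-∀
    +d≡v-lo : + ∣ v -ℤ lo ∣ ≡ v -ℤ lo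
    +d≡v-lo = ℤ.0≤i⇒+∣i∣≡i (ℤ.i≤j⇒0≤j-i (proj₁ (All.lookup bounds v∈xs)))
    lo+d≡v : lo +ℤ + ∣ v -ℤ lo ∣ ≡ v
    lo+d≡v = trans (cong (lo +ℤ_) +d≡v-lo) (lemma₁ lo v)
    d<r : ∣ v -ℤ lo ∣ < r
    d<r = ℤ.drop‿+<+ (begin-strict
      + ∣ v -ℤ lo ∣    ≡⟨ +d≡v-lo ⟩
      v -ℤ lo          <⟨ ℤ.+-monoˡ-< (-ℤ lo) (proj₂ (All.lookup bounds v∈xs)) ⟩
      lo +ℤ + r -ℤ lo  ≡⟨ lemma₂ lo (+ r) ⟩
      + r              ∎)
      where open ℤ.≤-Reasoning

diameter-pigeonhole : ∀ {xs} k → Unique xs → AllPairs (Close k) xs → length xs ≤ suc k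
diameter-pigeonhole {[]}     k _   _      = z≤n
diameter-pigeonhole {x ∷ xs} k !xs closeₓₛ =
  interval-pigeonhole lo (suc k) !xs
    (All.zipWith (λ (lo≤v , v≤lo+k) → lo≤v , ℤ.≤-<-trans v≤lo+k (ℤ.+-monoʳ-< lo (+<+ (ℕ.n<1+n k))))
                 (min≤xs x (x ∷ xs) , all≤lo+k))
  where
  open Extrema ℤ.≤-totalOrder using (min; min≤xs; argmin-all)
  lo = min x (x ∷ xs)
  all≤_+k : ℤ → Set
  all≤ m +k = All (_≤ℤ m +ℤ + k) (x ∷ xs)
  within : ∀ {v} → v ∈ x ∷ xs → all≤ v +k
  within v∈ = All.tabulate λ w∈ → proj₂ (close-pairwise closeₓₛ v∈ w∈)
  all≤lo+k : all≤ lo +k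
  all≤lo+k = argmin-all id (within (here refl)) (All.tabulate within)

no-room : ∀ k .{{_ : NonZero k}} {a b xs} → Unique xs → length xs ≡ k → a +ℤ + (2 + k) ≤ℤ b →
          All (λ v → Close k a v × Close k v b) xs → ⊥
no-room (suc k₁) {a} {b} !xs length≡k gap bounds =
  ℕ.n≮n k₁ (subst (_≤ k₁) length≡k (interval-pigeonhole (b -ℤ + suc k₁) k₁ !xs (All.map between bounds)))
  where
  open ℤ.≤-Reasoning
  lemma₁ : ∀ a K → + 1 +ℤ (a +ℤ K) ≡ a +ℤ (+ 2 +ℤ K) -ℤ + 1
  lemma₁ = solve-∀
  lemma₂ : ∀ b k₁ → b -ℤ + 1 ≡ b -ℤ (+ 1 +ℤ k₁) +ℤ k₁
  lemma₂ = solve-∀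
  between : ∀ {v} → Close (suc k₁) a v × Close (suc k₁) v b → b -ℤ + suc k₁ ≤ℤ v × v <ℤ b -ℤ + suc k₁ +ℤ + k₁
  between {v} ((_ , v≤a+k) , (_ , b≤v+k)) = i≤j+k⇒i-k≤j b≤v+k , ℤ.suc[i]≤j⇒i<j (begin
    + 1 +ℤ v                         ≤⟨ ℤ.+-monoʳ-≤ (+ 1) v≤a+k ⟩
    + 1 +ℤ (a +ℤ + suc k₁)           ≡⟨ lemma₁ a (+ suc k₁) ⟩
    a +ℤ + (2 + suc k₁) -ℤ + 1       ≤⟨ ℤ.+-monoˡ-≤ (-ℤ + 1) gap ⟩
    b -ℤ + 1                         ≡⟨ lemma₂ b (+ k₁) ⟩
    b -ℤ + suc k₁ +ℤ + k₁            ∎)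

gap-exact : ∀ k {a b} → ¬ b ≤ℤ a +ℤ + k → ¬ a +ℤ + (2 + k) ≤ℤ b → b ≡ a +ℤ + suc k
gap-exact k {a} {b} b≰a+k a+2+k≰b = ℤ.≤-antisym
  (subst (b ≤ℤ_) (lemma₂ a (+ k)) (ℤ.i<j⇒i≤pred[j] (ℤ.≰⇒> a+2+k≰b)))
  (subst (_≤ℤ b) (lemma₁ a (+ k)) (ℤ.i<j⇒suc[i]≤j (ℤ.≰⇒> b≰a+k)))
  where
  lemma₁ : ∀ a k → + 1 +ℤ (a +ℤ k) ≡ a +ℤ (+ 1 +ℤ k)
  lemma₁ = solve-∀
  lemma₂ : ∀ a k → -ℤ + 1 +ℤ (a +ℤ (+ 2 +ℤ k)) ≡ a +ℤ (+ 1 +ℤ k)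
  lemma₂ = solve-∀

gap-cases : ∀ k {a b} → ¬ Close k a b → ¬ a +ℤ + (2 + k) ≤ℤ b → ¬ b +ℤ + (2 + k) ≤ℤ a →
            b ≡ a +ℤ + suc k ⊎ b ≡ a -ℤ + suc k
gap-cases k {a} {b} ¬close a+2+k≰b b+2+k≰a with b ℤ.≤? a +ℤ + k
... | no  b≰a+k = inj₁ (gap-exact k {a} b≰a+k a+2+k≰b)
... | yes b≤a+k = inj₂ (begin
  b                       ≡⟨ lemma b (+ suc k) ⟩
  b +ℤ + suc k -ℤ + suc k ≡⟨ cong (_-ℤ + suc k) (≡.sym (gap-exact k {b} (λ a≤b+k → ¬close (a≤b+k , b≤a+k)) b+2+k≰a)) ⟩
  a -ℤ + suc k            ∎)
  where
  open ≡-Reasoning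
  lemma : ∀ b K → b ≡ b +ℤ K -ℤ K
  lemma = solve-∀

i≰i-2 : ∀ a → ¬ a ≤ℤ a -ℤ + 2
i≰i-2 a a≤a-2 = contradiction (subst (+ 0 ≤ℤ_) (lemma a) (ℤ.i≤j⇒0≤j-i a≤a-2)) λ ()
  where
  lemma : ∀ a → a -ℤ + 2 -ℤ a ≡ -ℤ + 2
  lemma = solve-∀

module IntegerRigidity (k s : ℕ) .{{_ : NonZero k}} (2k+1≤s : 2 * k + 1 ≤ s) (ψ : ℕ → ℤ)
  (close     : ∀ {x y} → x < y → y < s → y ≤ x + k → Close k (ψ x) (ψ y))
  (injective : ∀ {x y} → x < y → y < s → ψ x ≢ ψ y) where

  private
    k+k+1≤s : k + suc k ≤ s
    k+k+1≤s = subst (_≤ s) (trans (ℕ.+-comm (2 * k) 1)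
                               (trans (cong (λ m → suc (k + m)) (ℕ.+-identityʳ k)) (≡.sym (ℕ.+-suc k k))))
                    2k+1≤s

    0<k : 0 < k
    0<k = >-nonZero⁻¹ k

    inner< : ∀ {x i} → x + suc k < s → i ≤ k → suc x + i < s
    inner< {x} bound i≤k = ℕ.≤-<-trans (ℕ.≤-trans (ℕ.+-monoʳ-≤ (suc x) i≤k) (ℕ.≤-reflexive (≡.sym (ℕ.+-suc x k)))) bound

  following : ℕ → ℕ → List ℤ
  following x l = applyUpTo (λ i → ψ (suc x + i)) l

  following-unique : ∀ {x l} → l ≤ suc k → x + suc k < s → Unique (following x l)
  following-unique {x} {l} l≤ bound = Unique.applyUpTo⁺₁ (λ i → ψ (suc x + i)) l λ i<j j<l →
    injective (ℕ.+-monoʳ-< (suc x) i<j) (inner< bound (ℕ.≤-pred (ℕ.≤-trans j<l l≤)))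

  close-to-start : ∀ {x i} → x + suc k < s → i < k → Close k (ψ x) (ψ (suc x + i))
  close-to-start {x} {i} bound i<k =
    close (s≤s (ℕ.m≤m+n x i)) (inner< bound (ℕ.<⇒≤ i<k))
          (ℕ.≤-trans (ℕ.≤-reflexive (≡.sym (ℕ.+-suc x i))) (ℕ.+-monoʳ-≤ x i<k))

  close-to-end : ∀ {x i} → x + suc k < s → i < k → Close k (ψ (suc x + i)) (ψ (x + suc k))
  close-to-end {x} {i} bound i<k = close
    (ℕ.≤-trans (s≤s (ℕ.+-monoʳ-< x i<k)) (ℕ.≤-reflexive (≡.sym (ℕ.+-suc x k)))) bound
    (ℕ.≤-trans (ℕ.≤-reflexive (ℕ.+-suc x k)) (s≤s (ℕ.+-monoˡ-≤ k (ℕ.m≤m+n x i))))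

  span-not-close : ∀ x → x + suc k < s → ¬ Close k (ψ x) (ψ (x + suc k))
  span-not-close x bound c = ℕ.n≮n (suc k)
    (subst (λ l → suc l ≤ suc k) (length-applyUpTo (λ i → ψ (suc x + i)) (suc k)) (diameter-pigeonhole k unique pairwise))
    where
    unique : Unique (ψ x ∷ following x (suc k))
    unique = All.applyUpTo⁺₁ (λ i → ψ (suc x + i)) (suc k) (λ i<sk → injective (s≤s (ℕ.m≤m+n x _)) (inner< bound (ℕ.≤-pred i<sk)))
             ∷ following-unique ℕ.≤-refl bound
    first : ∀ {i} → i < suc k → Close k (ψ x) (ψ (suc x + i))
    first {i} i<sk with ℕ.m≤n⇒m<n∨m≡n (ℕ.≤-pred i<sk)
    ... | inj₁ i<k  = close-to-start bound i<k
    ... | inj₂ refl = subst (λ y → Close k (ψ x) (ψ y)) (ℕ.+-suc x k) c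
    pairwise : AllPairs (Close k) (ψ x ∷ following x (suc k))
    pairwise = All.applyUpTo⁺₁ (λ i → ψ (suc x + i)) (suc k) first ∷
               AllPairs.applyUpTo⁺₁ (λ i → ψ (suc x + i)) (suc k) λ {i} {j} i<j j<sk →
                 close (ℕ.+-monoʳ-< (suc x) i<j) (inner< bound (ℕ.≤-pred j<sk))
                       (ℕ.≤-trans (ℕ.+-monoʳ-≤ (suc x) (ℕ.≤-pred j<sk)) (ℕ.+-monoˡ-≤ k (ℕ.m≤m+n (suc x) i)))

  -- The k values strictly between ψ x and ψ (x + suc k) are within k of both ends, so the ends can
  -- be neither within k of each other (k+2 values in k+1 places) nor k+2 or more apart (k values
  -- in at most k−1 places).
  span : ∀ x → x + suc k < s → ψ (x + suc k) ≡ ψ x +ℤ + suc k ⊎ ψ (x + suc k) ≡ ψ x -ℤ + suc k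
  span x bound = gap-cases k (span-not-close x bound)
    (λ gap → no-room k unique length≡k gap (All.zip (starts , ends)))
    (λ gap → no-room k unique length≡k gap (All.zip (All.map close-sym ends , All.map close-sym starts)))
    where
    unique = following-unique (ℕ.n≤1+n k) bound
    length≡k = length-applyUpTo (λ i → ψ (suc x + i)) k
    starts = All.applyUpTo⁺₁ (λ i → ψ (suc x + i)) k (close-to-start bound)
    ends = All.applyUpTo⁺₁ (λ i → ψ (suc x + i)) k (close-to-end bound)

  span-persists : ∀ x → suc x + suc k < s → ψ (x + suc k) ≡ ψ x +ℤ + suc k → ψ (suc x + suc k) ≡ ψ (suc x) +ℤ + suc k
  span-persists x bound up = [ id , (λ down′ → ⊥-elim (i≰i-2 (ψ x +ℤ + suc k) (decrease down′))) ]′ (span (suc x) bound)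
    where
    open ℤ.≤-Reasoning
    x+1<s : suc x < s
    x+1<s = ℕ.≤-<-trans (s≤s (ℕ.m≤m+n x (suc k))) bound
    x+1≤x+k : ψ (suc x) ≤ℤ ψ x +ℤ + k
    x+1≤x+k = proj₂ (close (ℕ.n<1+n x) x+1<s (ℕ.m<m+n x 0<k))
    lemma : ∀ a k → a +ℤ k -ℤ (+ 1 +ℤ k) +ℤ k ≡ a +ℤ (+ 1 +ℤ k) -ℤ + 2
    lemma = solve-∀
    decrease : ψ (suc x + suc k) ≡ ψ (suc x) -ℤ + suc k → ψ x +ℤ + suc k ≤ℤ ψ x +ℤ + suc k -ℤ + 2
    decrease down′ = begin
      ψ x +ℤ + suc k                      ≡⟨ ≡.sym up ⟩
      ψ (x + suc k)                       ≤⟨ proj₁ (close (ℕ.n<1+n _) bound (ℕ.m<m+n (x + suc k) 0<k)) ⟩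
      ψ (suc x + suc k) +ℤ + k            ≡⟨ cong (_+ℤ + k) down′ ⟩
      ψ (suc x) -ℤ + suc k +ℤ + k         ≤⟨ ℤ.+-monoˡ-≤ (+ k) (ℤ.+-monoˡ-≤ (-ℤ + suc k) x+1≤x+k) ⟩
      ψ x +ℤ + k -ℤ + suc k +ℤ + k        ≡⟨ lemma (ψ x) (+ k) ⟩
      ψ x +ℤ + suc k -ℤ + 2               ∎

  initial-span : ψ (0 + suc k) ≡ ψ 0 +ℤ + suc k ⊎ ψ (0 + suc k) ≡ ψ 0 -ℤ + suc k
  initial-span = span 0 (ℕ.≤-trans (s≤s (ℕ.m<m+n k 0<k)) (ℕ.≤-trans (ℕ.≤-reflexive (≡.sym (ℕ.+-suc k k))) k+k+1≤s))

  module Upward (up₀ : ψ (0 + suc k) ≡ ψ 0 +ℤ + suc k) where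

    up : ∀ x → x + suc k < s → ψ (x + suc k) ≡ ψ x +ℤ + suc k
    up zero    _     = up₀
    up (suc x) bound = span-persists x bound (up x (ℕ.<-trans (ℕ.n<1+n _) bound))

    anchored : ∀ t → suc t < s → t + suc k < s ⊎ Σ ℕ λ z → z + k ≡ t × z + suc k < s
    anchored t t+1<s with t + suc k ℕ.<? s
    ... | yes t+k+1<s = inj₁ t+k+1<s
    ... | no  t+k+1≮s = inj₂ (t ∸ k , ℕ.m∸n+n≡m k≤t , subst (_< s) (≡.sym shift) t+1<s)
      where
      k≤t : k ≤ t
      k≤t = ℕ.+-cancelʳ-≤ (suc k) k t (ℕ.≤-trans k+k+1≤s (ℕ.≮⇒≥ t+k+1≮s))
      shift : t ∸ k + suc k ≡ suc t
      shift = trans (ℕ.+-suc (t ∸ k) k) (cong suc (ℕ.m∸n+n≡m k≤t))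

    step-≥ : ∀ t → suc t < s → ψ t +ℤ + 1 ≤ℤ ψ (suc t)
    step-≥ t t+1<s with anchored t t+1<s
    ... | inj₁ t+k+1<s = begin
      ψ t +ℤ + 1                ≡⟨ lemma (ψ t) (+ k) ⟩
      ψ t +ℤ + suc k -ℤ + k     ≡⟨ cong (_-ℤ + k) (≡.sym (up t t+k+1<s)) ⟩
      ψ (t + suc k) -ℤ + k      ≤⟨ i≤j+k⇒i-k≤j (proj₂ (close t+1<t+k+1 t+k+1<s (ℕ.≤-reflexive (ℕ.+-suc t k)))) ⟩
      ψ (suc t)                 ∎
      where
      open ℤ.≤-Reasoning
      lemma : ∀ a k → a +ℤ + 1 ≡ a +ℤ (+ 1 +ℤ k) -ℤ k
      lemma = solve-∀
      t+1<t+k+1 : suc t < t + suc k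
      t+1<t+k+1 = subst (suc t <_) (≡.sym (ℕ.+-suc t k)) (s≤s (ℕ.m<m+n t 0<k))
    ... | inj₂ (z , refl , z+k+1<s) = begin
      ψ (z + k) +ℤ + 1          ≤⟨ ℤ.+-monoˡ-≤ (+ 1) (proj₂ (close (ℕ.m<m+n z 0<k) (ℕ.≤-<-trans (ℕ.n≤1+n _) t+1<s) ℕ.≤-refl)) ⟩
      ψ z +ℤ + k +ℤ + 1         ≡⟨ lemma (ψ z) (+ k) ⟩
      ψ z +ℤ + suc k            ≡⟨ ≡.sym (up z z+k+1<s) ⟩
      ψ (z + suc k)             ≡⟨ cong ψ (ℕ.+-suc z k) ⟩
      ψ (suc (z + k))           ∎
      where
      open ℤ.≤-Reasoning
      lemma : ∀ a k → a +ℤ k +ℤ + 1 ≡ a +ℤ (+ 1 +ℤ k)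
      lemma = solve-∀

    climb : ∀ a j → a + j < s → ψ a +ℤ + j ≤ℤ ψ (a + j)
    climb a zero    _       = ℤ.≤-reflexive (trans (ℤ.+-identityʳ (ψ a)) (cong ψ (≡.sym (ℕ.+-identityʳ a))))
    climb a (suc j) a+j+1<s = begin
      ψ a +ℤ + suc j            ≡⟨ lemma (ψ a) (+ j) ⟩
      ψ a +ℤ + j +ℤ + 1         ≤⟨ ℤ.+-monoˡ-≤ (+ 1) (climb a j (ℕ.<-trans (ℕ.n<1+n _) a+j+1<s′)) ⟩
      ψ (a + j) +ℤ + 1          ≤⟨ step-≥ (a + j) a+j+1<s′ ⟩
      ψ (suc (a + j))           ≡⟨ cong ψ (≡.sym (ℕ.+-suc a j)) ⟩
      ψ (a + suc j)             ∎
      where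
      open ℤ.≤-Reasoning
      a+j+1<s′ : suc (a + j) < s
      a+j+1<s′ = subst (_< s) (ℕ.+-suc a j) a+j+1<s
      lemma : ∀ a j → a +ℤ (+ 1 +ℤ j) ≡ a +ℤ j +ℤ + 1
      lemma = solve-∀

    step-≤ : ∀ t → suc t < s → ψ (suc t) ≤ℤ ψ t +ℤ + 1
    step-≤ t t+1<s with anchored t t+1<s
    ... | inj₁ t+k+1<s = begin
      ψ (suc t)                 ≡⟨ lemma (ψ (suc t)) (+ k) ⟩
      ψ (suc t) +ℤ + k -ℤ + k   ≤⟨ ℤ.+-monoˡ-≤ (-ℤ + k) (climb (suc t) k (subst (_< s) (ℕ.+-suc t k) t+k+1<s)) ⟩
      ψ (suc t + k) -ℤ + k      ≡⟨ cong (λ y → ψ y -ℤ + k) (≡.sym (ℕ.+-suc t k)) ⟩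
      ψ (t + suc k) -ℤ + k      ≡⟨ cong (_-ℤ + k) (up t t+k+1<s) ⟩
      ψ t +ℤ + suc k -ℤ + k     ≡⟨ lemma′ (ψ t) (+ k) ⟩
      ψ t +ℤ + 1                ∎
      where
      open ℤ.≤-Reasoning
      lemma : ∀ b k → b ≡ b +ℤ k -ℤ k
      lemma = solve-∀
      lemma′ : ∀ a k → a +ℤ (+ 1 +ℤ k) -ℤ k ≡ a +ℤ + 1
      lemma′ = solve-∀
    ... | inj₂ (z , refl , z+k+1<s) = begin
      ψ (suc (z + k))           ≡⟨ cong ψ (≡.sym (ℕ.+-suc z k)) ⟩
      ψ (z + suc k)             ≡⟨ up z z+k+1<s ⟩
      ψ z +ℤ + suc k            ≡⟨ lemma (ψ z) (+ k) ⟩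
      ψ z +ℤ + k +ℤ + 1         ≤⟨ ℤ.+-monoˡ-≤ (+ 1) (climb z k (ℕ.≤-<-trans (ℕ.n≤1+n _) t+1<s)) ⟩
      ψ (z + k) +ℤ + 1          ∎
      where
      open ℤ.≤-Reasoning
      lemma : ∀ a k → a +ℤ (+ 1 +ℤ k) ≡ a +ℤ k +ℤ + 1
      lemma = solve-∀

    unit-steps : ∀ t → suc t < s → ψ (suc t) ≡ ψ t +ℤ + 1
    unit-steps t t+1<s = ℤ.≤-antisym (step-≤ t t+1<s) (step-≥ t t+1<s)

-- The decreasing case is the increasing one for −ψ.
integer-rigidity : ∀ k s .{{_ : NonZero k}} → 2 * k + 1 ≤ s → (ψ : ℕ → ℤ) →
                   (∀ {x y} → x < y → y < s → y ≤ x + k → Close k (ψ x) (ψ y)) →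
                   (∀ {x y} → x < y → y < s → ψ x ≢ ψ y) →
                   ∃ λ ε → (ε ≡ + 1 ⊎ ε ≡ -ℤ + 1) × ∀ t → suc t < s → ψ (suc t) ≡ ψ t +ℤ ε
integer-rigidity k s 2k+1≤s ψ close injective = [ upward , downward ]′ Rigid.initial-span
  where
  module Rigid  = IntegerRigidity k s 2k+1≤s ψ close injective
  module Rigid⁻ = IntegerRigidity k s 2k+1≤s (λ t → -ℤ ψ t)
                    (λ x<y y<s y≤x+k → close-neg (close x<y y<s y≤x+k)) (λ x<y y<s → injective x<y y<s ∘ ℤ.neg-injective)
  negate : ∀ {a b} K → a ≡ b -ℤ K → -ℤ a ≡ -ℤ b +ℤ K
  negate {a} {b} K refl = lemma b K
    where
    lemma : ∀ b K → -ℤ (b -ℤ K) ≡ -ℤ b +ℤ K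
    lemma = solve-∀
  upward = λ up₀ → + 1 , inj₁ refl , Rigid.Upward.unit-steps up₀
  downward = λ down₀ → -ℤ + 1 , inj₂ refl , λ t t+1<s →
    trans (≡.sym (ℤ.neg-involutive _))
          (trans (cong -ℤ_ (Rigid⁻.Upward.unit-steps (negate {b = ψ 0} (+ suc k) down₀) t t+1<s)) (lemma (ψ t)))
    where
    lemma : ∀ a → -ℤ (-ℤ a +ℤ + 1) ≡ a +ℤ -ℤ + 1
    lemma = solve-∀

offsets : ℕ → List ℤ
offsets k = map (λ i → + suc i) (upTo k) ++ map (λ i → -ℤ + suc i) (upTo k)

length-offsets : ∀ k → length (offsets k) ≡ k + k
length-offsets k = trans (length-++ (map (λ i → + suc i) (upTo k)))
  (cong₂ _+_ (trans (length-map _ (upTo k)) (length-upTo k)) (trans (length-map _ (upTo k)) (length-upTo k)))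

∣offset∣≤ : ∀ {k z} → z ∈ offsets k → ∣ z ∣ ≤ k
∣offset∣≤ {k} z∈ with ∈-++⁻ (map (λ i → + suc i) (upTo k)) z∈
... | inj₁ z∈⁺ with i , i∈ , refl ← ∈-map⁻ (λ i → + suc i) z∈⁺ = ∈-upTo⁻ i∈
... | inj₂ z∈⁻ with i , i∈ , refl ← ∈-map⁻ (λ i → -ℤ + suc i) z∈⁻ = ∈-upTo⁻ i∈

offset-close : ∀ {k z} a → z ∈ offsets k → Close k a (a +ℤ z)
offset-close {k} a z∈ with ∈-++⁻ (map (λ i → + suc i) (upTo k)) z∈
... | inj₁ z∈⁺ with i , i∈ , refl ← ∈-map⁻ (λ i → + suc i) z∈⁺ =
  ℤ.≤-trans (ℤ.i≤i+j a (+ suc i)) (ℤ.i≤i+j _ (+ k)) , ℤ.+-monoʳ-≤ a (ℤ.+≤+ (∈-upTo⁻ i∈))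
... | inj₂ z∈⁻ with i , i∈ , refl ← ∈-map⁻ (λ i → -ℤ + suc i) z∈⁻ =
  ℤ.≤-trans (ℤ.≤-reflexive (lemma a (+ suc i))) (ℤ.+-monoʳ-≤ (a -ℤ + suc i) (ℤ.+≤+ (∈-upTo⁻ i∈))) ,
  ℤ.≤-trans (ℤ.i-j≤i a (+ suc i)) (ℤ.i≤i+j a (+ k))
  where
  lemma : ∀ a i → a ≡ a -ℤ i +ℤ i
  lemma = solve-∀

≡ᵇ-true⁻ : ∀ {m n} → (m ≡ᵇ n) ≡ true → m ≡ n
≡ᵇ-true⁻ {m} {n} h = ℕ.≡ᵇ⇒≡ m n (Equivalence.from T-≡ h)

≡ᵇ-true⁺ : ∀ {m n} → m ≡ n → (m ≡ᵇ n) ≡ true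
≡ᵇ-true⁺ {m} {n} m≡n = Equivalence.to T-≡ (ℕ.≡⇒≡ᵇ m n m≡n)

forward : ∀ {n} .{{_ : NonZero n}} → Fin n → ℕ → Fin n → Bool
forward {n} u j v = (toℕ u + suc j) % n ≡ᵇ toℕ v

-- adjH computes only once the number of vertices is a successor.
adjH-unfold : ∀ {n} .{{_ : NonZero n}} k (u v : Fin n) →
              adjH k u v ≡ not ⌊ u Fin.≟ v ⌋ ∧ anyL (λ j → forward u j v ∨ forward v j u) (upTo k)
adjH-unfold {suc n} k u v = refl

module CyclePower (k n : ℕ) .{{_ : NonZero n}} where
  open Modulo n

  offsetAmong : Fin n → Fin n → List ℕ → ℤ
  offsetAmong u v []       = + 0
  offsetAmong u v (j ∷ js) = if forward u j v then + suc j else if forward v j u then -ℤ + suc j else offsetAmong u v js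

  offset : Fin n → Fin n → ℤ
  offset u v = offsetAmong u v (upTo k)

  adjH⇒offset : ∀ {u v} → adjH k u v ≡ true → offset u v ∈ offsets k × + toℕ v ≡ₘ + toℕ u +ℤ offset u v
  adjH⇒offset {u} {v} u~v =
    among (upTo k) (All.tabulate ∈-upTo⁻) (∧-conicalʳ (not ⌊ u Fin.≟ v ⌋) _ (trans (≡.sym (adjH-unfold k u v)) u~v))
    where
    lemma : ∀ u J → u ≡ u +ℤ J +ℤ -ℤ J
    lemma = solve-∀
    among : ∀ js → All (_< k) js → anyL (λ j → forward u j v ∨ forward v j u) js ≡ true →
            offsetAmong u v js ∈ offsets k × + toℕ v ≡ₘ + toℕ u +ℤ offsetAmong u v js
    among (j ∷ js) (j<k ∷ js<k) found with forward u j v in fwd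
    ... | true  = ∈-++⁺ˡ (∈-map⁺ (λ i → + suc i) (∈-upTo⁺ j<k)) , %⇒≡ₘ {toℕ u} {suc j} (≡ᵇ-true⁻ fwd)
    ... | false with forward v j u in bwd
    ...   | true  = ∈-++⁺ʳ _ (∈-map⁺ (λ i → -ℤ + suc i) (∈-upTo⁺ j<k)) ,
                    ≡ₘ-trans (≡⇒≡ₘ (lemma (+ toℕ v) (+ suc j)))
                             (+-cong-≡ₘ (≡ₘ-sym (%⇒≡ₘ {toℕ v} {suc j} (≡ᵇ-true⁻ bwd))) (≡ₘ-refl { -ℤ + suc j}))
    ...   | false = among js js<k found

  path-adjH : ∀ {u v : Fin n} → toℕ u < toℕ v → toℕ v ≤ toℕ u + k → adjH k u v ≡ true
  path-adjH {u} {v} u<v v≤u+k =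
    trans (adjH-unfold k u v) (cong₂ _∧_ (cong not (trans (isYes≗does (u Fin.≟ v)) (dec-false (u Fin.≟ v) u≢v)))
                                    (anyL⁺ _ (∈-upTo⁺ j<k) (cong (_∨ forward v j u) (≡ᵇ-true⁺ u+j+1%n≡v))))
    where
    j = toℕ v ∸ suc (toℕ u)
    u≢v : u ≢ v
    u≢v u≡v = ℕ.<-irrefl (cong toℕ u≡v) u<v
    u+j+1≡v : toℕ u + suc j ≡ toℕ v
    u+j+1≡v = trans (ℕ.+-suc (toℕ u) j) (ℕ.m+[n∸m]≡n u<v)
    u+j+1%n≡v : (toℕ u + suc j) % n ≡ toℕ v
    u+j+1%n≡v = trans (cong (_% n) u+j+1≡v) (m<n⇒m%n≡m (Fin.toℕ<n v))
    j<k : j < k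
    j<k = ℕ.+-cancelˡ-≤ (toℕ u) (suc j) k (subst (_≤ toℕ u + k) (≡.sym u+j+1≡v) v≤u+k)

-- Embedded powers of a path are rigid

module PathPower (k n : ℕ) .{{_ : NonZero k}} .{{_ : NonZero n}} (k*k+k<n : k * k + k < n) where
  open Modulo n
  open CyclePower k n

  record EmbedsPathPower (s : ℕ) (φ : ℕ → Fin n) : Set where
    field
      injective : ∀ {x y} → x < y → y < s → φ x ≢ φ y
      adjacent  : ∀ {x y} → x < y → y < s → y ≤ x + k → adjH k (φ x) (φ y) ≡ true

  lift : (ℕ → Fin n) → ℕ → ℤ
  lift φ zero    = + 0
  lift φ (suc t) = lift φ t +ℤ offset (φ t) (φ (suc t))

  orientation : (ℕ → Fin n) → Bool
  orientation φ = ⌊ offset (φ 0) (φ 1) ℤ.≟ + 1 ⌋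

  record Progression (s : ℕ) (φ : ℕ → Fin n) : Set where
    field
      step         : ℤ
      step≡±1      : step ≡ + 1 ⊎ step ≡ -ℤ + 1
      first-offset : offset (φ 0) (φ 1) ≡ step
      position     : ∀ t → t < s → + toℕ (φ t) ≡ₘ + toℕ (φ 0) +ℤ step *ℤ + t

  module Lift {s φ} (emb : EmbedsPathPower s φ) where
    open EmbedsPathPower emb

    private
      ψ = lift φ

      0<k : 0 < k
      0<k = >-nonZero⁻¹ k

    step-offset : ∀ {t} → suc t < s →
                  offset (φ t) (φ (suc t)) ∈ offsets k × + toℕ (φ (suc t)) ≡ₘ + toℕ (φ t) +ℤ offset (φ t) (φ (suc t))
    step-offset {t} t+1<s = adjH⇒offset (adjacent (ℕ.n<1+n t) t+1<s (ℕ.m<m+n t 0<k))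

    lift-≡ₘ : ∀ t → t < s → + toℕ (φ t) ≡ₘ + toℕ (φ 0) +ℤ ψ t
    lift-≡ₘ zero    _      = ≡⇒≡ₘ (≡.sym (ℤ.+-identityʳ _))
    lift-≡ₘ (suc t) t+1<s = begin
      + toℕ (φ (suc t))                              ≈⟨ proj₂ (step-offset t+1<s) ⟩
      + toℕ (φ t) +ℤ offset (φ t) (φ (suc t))        ≈⟨ +-cong-≡ₘ (lift-≡ₘ t (ℕ.<-trans (ℕ.n<1+n t) t+1<s)) ≡ₘ-refl ⟩
      + toℕ (φ 0) +ℤ ψ t +ℤ offset (φ t) (φ (suc t)) ≡⟨ ℤ.+-assoc (+ toℕ (φ 0)) (ψ t) _ ⟩
      + toℕ (φ 0) +ℤ ψ (suc t)                       ∎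
      where open SetoidReasoning ≡ₘ-setoid

    lift-drift : ∀ x d → x + d < s → ∣ ψ (x + d) -ℤ ψ x ∣ ≤ d * k
    lift-drift x zero x<s rewrite ℕ.+-identityʳ x = ℕ.≤-reflexive (cong ∣_∣ (ℤ.+-inverseʳ (ψ x)))
    lift-drift x (suc d) x+d+1<s rewrite ℕ.+-suc x d = begin
      ∣ ψ (x + d) +ℤ step -ℤ ψ x ∣             ≡⟨ cong ∣_∣ (lemma (ψ (x + d)) (ψ x) step) ⟩
      ∣ ψ (x + d) -ℤ ψ x +ℤ step ∣             ≤⟨ ℤ.∣i+j∣≤∣i∣+∣j∣ (ψ (x + d) -ℤ ψ x) step ⟩
      ∣ ψ (x + d) -ℤ ψ x ∣ + ∣ step ∣          ≤⟨ ℕ.+-mono-≤ (lift-drift x d (ℕ.<-trans (ℕ.n<1+n _) x+d+1<s))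
                                                               (∣offset∣≤ (proj₁ (step-offset x+d+1<s))) ⟩
      d * k + k                                ≡⟨ ℕ.+-comm (d * k) k ⟩
      suc d * k                                ∎
      where
      open ℕ.≤-Reasoning
      step = offset (φ (x + d)) (φ (suc (x + d)))
      lemma : ∀ a b c → a +ℤ c -ℤ b ≡ a -ℤ b +ℤ c
      lemma = solve-∀

    -- Both sides are congruent modulo n and differ by at most k * k + k < n.
    lift-offset : ∀ {x y} → x < y → y < s → y ≤ x + k → ψ y ≡ ψ x +ℤ offset (φ x) (φ y)
    lift-offset {x} {y} x<y y<s y≤x+k = ≡ₘ∧∣-∣<⇒≡ (+-cancelˡ-≡ₘ (+ toℕ (φ 0)) congruent) small
      where
      z = offset (φ x) (φ y)
      x~y = adjH⇒offset (adjacent x<y y<s y≤x+k)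
      congruent : + toℕ (φ 0) +ℤ ψ y ≡ₘ + toℕ (φ 0) +ℤ (ψ x +ℤ z)
      congruent = begin
        + toℕ (φ 0) +ℤ ψ y         ≈⟨ ≡ₘ-sym (lift-≡ₘ y y<s) ⟩
        + toℕ (φ y)                ≈⟨ proj₂ x~y ⟩
        + toℕ (φ x) +ℤ z           ≈⟨ +-cong-≡ₘ (lift-≡ₘ x (ℕ.<-trans x<y y<s)) ≡ₘ-refl ⟩
        + toℕ (φ 0) +ℤ ψ x +ℤ z    ≡⟨ ℤ.+-assoc (+ toℕ (φ 0)) (ψ x) z ⟩
        + toℕ (φ 0) +ℤ (ψ x +ℤ z)  ∎
        where open SetoidReasoning ≡ₘ-setoid
      d = y ∸ x
      x+d≡y : x + d ≡ y
      x+d≡y = ℕ.m+[n∸m]≡n (ℕ.<⇒≤ x<y)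
      d≤k : d ≤ k
      d≤k = ℕ.+-cancelˡ-≤ x d k (subst (_≤ x + k) (≡.sym x+d≡y) y≤x+k)
      drift : ∣ ψ y -ℤ ψ x ∣ ≤ k * k
      drift = ℕ.≤-trans (subst (λ u → ∣ ψ u -ℤ ψ x ∣ ≤ d * k) x+d≡y (lift-drift x d (subst (_< s) (≡.sym x+d≡y) y<s)))
                        (ℕ.*-monoˡ-≤ k d≤k)
      lemma : ∀ a b c → a -ℤ (b +ℤ c) ≡ a -ℤ b -ℤ c
      lemma = solve-∀
      small : ∣ ψ y -ℤ (ψ x +ℤ z) ∣ < n
      small = begin-strict
        ∣ ψ y -ℤ (ψ x +ℤ z) ∣      ≡⟨ cong ∣_∣ (lemma (ψ y) (ψ x) z) ⟩
        ∣ ψ y -ℤ ψ x -ℤ z ∣        ≤⟨ ℤ.∣i-j∣≤∣i∣+∣j∣ (ψ y -ℤ ψ x) z ⟩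
        ∣ ψ y -ℤ ψ x ∣ + ∣ z ∣     ≤⟨ ℕ.+-mono-≤ drift (∣offset∣≤ (proj₁ x~y)) ⟩
        k * k + k                  <⟨ k*k+k<n ⟩
        n                          ∎
        where open ℕ.≤-Reasoning

    lift-close : ∀ {x y} → x < y → y < s → y ≤ x + k → Close k (ψ x) (ψ y)
    lift-close x<y y<s y≤x+k = subst (Close k _) (≡.sym (lift-offset x<y y<s y≤x+k))
                                 (offset-close _ (proj₁ (adjH⇒offset (adjacent x<y y<s y≤x+k))))

    lift-injective : ∀ {x y} → x < y → y < s → ψ x ≢ ψ y
    lift-injective {x} {y} x<y y<s ψx≡ψy = injective x<y y<s (toℕ-≡ₘ-injective (begin
      + toℕ (φ x)           ≈⟨ lift-≡ₘ x (ℕ.<-trans x<y y<s) ⟩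
      + toℕ (φ 0) +ℤ ψ x    ≡⟨ cong (+ toℕ (φ 0) +ℤ_) ψx≡ψy ⟩
      + toℕ (φ 0) +ℤ ψ y    ≈⟨ ≡ₘ-sym (lift-≡ₘ y y<s) ⟩
      + toℕ (φ y)           ∎))
      where open SetoidReasoning ≡ₘ-setoid

    progression : 2 * k + 1 ≤ s → Progression s φ
    progression 2k+1≤s = record
      { step = ε ; step≡±1 = ±1 ; first-offset = first-offset
      ; position = λ t t<s → ≡ₘ-trans (lift-≡ₘ t t<s) (≡⇒≡ₘ (cong (+ toℕ (φ 0) +ℤ_) (ψ≡εt t t<s))) }
      where
      rigid = integer-rigidity k s 2k+1≤s ψ lift-close lift-injective
      ε = proj₁ rigid
      ±1 = proj₁ (proj₂ rigid)
      steps : ∀ t → suc t < s → ψ (suc t) ≡ ψ t +ℤ ε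
      steps = proj₂ (proj₂ rigid)
      lemma : ∀ ε t → ε *ℤ t +ℤ ε ≡ ε *ℤ (+ 1 +ℤ t)
      lemma = solve-∀
      ψ≡εt : ∀ t → t < s → ψ t ≡ ε *ℤ + t
      ψ≡εt zero    _      = ≡.sym (ℤ.*-zeroʳ ε)
      ψ≡εt (suc t) t+1<s = trans (steps t t+1<s) (trans (cong (_+ℤ ε) (ψ≡εt t (ℕ.<-trans (ℕ.n<1+n t) t+1<s))) (lemma ε (+ t)))
      1<s : 1 < s
      1<s = ℕ.≤-trans (ℕ.+-monoˡ-≤ 1 (ℕ.≤-trans 0<k (ℕ.m≤m+n k (k + 0)))) 2k+1≤s
      first-offset : offset (φ 0) (φ 1) ≡ ε
      first-offset = trans (≡.sym (ℤ.+-identityˡ _)) (trans (steps 0 1<s) (ℤ.+-identityˡ ε))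

  orientation-determines : ∀ {ε₁ ε₂} → ε₁ ≡ + 1 ⊎ ε₁ ≡ -ℤ + 1 → ε₂ ≡ + 1 ⊎ ε₂ ≡ -ℤ + 1 →
                           ⌊ ε₁ ℤ.≟ + 1 ⌋ ≡ ⌊ ε₂ ℤ.≟ + 1 ⌋ → ε₁ ≡ ε₂
  orientation-determines (inj₁ refl) (inj₁ refl) _  = refl
  orientation-determines (inj₂ refl) (inj₂ refl) _  = refl
  orientation-determines (inj₁ refl) (inj₂ refl) ()
  orientation-determines (inj₂ refl) (inj₁ refl) ()

  path-power-rigid : ∀ {s φ₁ φ₂} → 2 * k + 1 ≤ s → EmbedsPathPower s φ₁ → EmbedsPathPower s φ₂ →
                     orientation φ₁ ≡ orientation φ₂ → ∀ {a} → a < s → φ₁ a ≡ φ₂ a → ∀ t → t < s → φ₁ t ≡ φ₂ t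
  path-power-rigid {s} {φ₁} {φ₂} 2k+1≤s emb₁ emb₂ same-orientation {a} a<s φ₁a≡φ₂a t t<s =
    toℕ-≡ₘ-injective (begin
      + toℕ (φ₁ t)                ≈⟨ position₁ t t<s ⟩
      + toℕ (φ₁ 0) +ℤ ε₁ *ℤ + t   ≈⟨ +-cong-≡ₘ same-start (≡⇒≡ₘ (cong (λ ε → ε *ℤ + t) ε₁≡ε₂)) ⟩
      + toℕ (φ₂ 0) +ℤ ε₂ *ℤ + t   ≈⟨ ≡ₘ-sym (position₂ t t<s) ⟩
      + toℕ (φ₂ t)                ∎)
    where
    open SetoidReasoning ≡ₘ-setoid
    open Progression (Lift.progression emb₁ 2k+1≤s)
      renaming (step to ε₁; step≡±1 to ε₁≡±1; first-offset to first-offset₁; position to position₁)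
    open Progression (Lift.progression emb₂ 2k+1≤s)
      renaming (step to ε₂; step≡±1 to ε₂≡±1; first-offset to first-offset₂; position to position₂)
    ε₁≡ε₂ : ε₁ ≡ ε₂
    ε₁≡ε₂ = orientation-determines ε₁≡±1 ε₂≡±1
              (trans (cong (λ z → ⌊ z ℤ.≟ + 1 ⌋) (≡.sym first-offset₁))
                     (trans same-orientation (cong (λ z → ⌊ z ℤ.≟ + 1 ⌋) first-offset₂)))
    same-start : + toℕ (φ₁ 0) ≡ₘ + toℕ (φ₂ 0)
    same-start = +-cancelʳ-≡ₘ (ε₁ *ℤ + a) (begin
      + toℕ (φ₁ 0) +ℤ ε₁ *ℤ + a   ≈⟨ ≡ₘ-sym (position₁ a a<s) ⟩
      + toℕ (φ₁ a)                ≡⟨ cong (λ v → + toℕ v) φ₁a≡φ₂a ⟩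
      + toℕ (φ₂ a)                ≈⟨ position₂ a a<s ⟩
      + toℕ (φ₂ 0) +ℤ ε₂ *ℤ + a   ≡⟨ cong (λ ε → + toℕ (φ₂ 0) +ℤ ε *ℤ + a) (≡.sym ε₁≡ε₂) ⟩
      + toℕ (φ₂ 0) +ℤ ε₁ *ℤ + a   ∎)

-- Breadth-first levels

first-true : (P : ℕ → Bool) → ∀ t → P t ≡ true → Σ ℕ λ t′ → P t′ ≡ true × ∀ u → u < t′ → P u ≡ false
first-true P zero    Pt = zero , Pt , λ _ ()
first-true P (suc t) Pt with P zero in P0
... | true  = zero , P0 , λ _ ()
... | false with t′ , Pt′ , before ← first-true (λ u → P (suc u)) t Pt =
  suc t′ , Pt′ , λ { zero _ → P0 ; (suc u) (s≤s u<t′) → before u u<t′ }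

module Levels {m : ℕ} (F : Graph m) where

  IsRoot : Fin m → Set
  IsRoot a = isLeastInComponent F a ≡ true

  walk-++ : ∀ t₁ t₂ {a b c} → walk F t₁ a b ≡ true → walk F t₂ b c ≡ true → walk F (t₂ + t₁) a c ≡ true
  walk-++ t₁ zero {b = b} {c} a⇝b b⇝c with refl ← ⌊⌋-true⁻ (b Fin.≟ c) b⇝c = a⇝b
  walk-++ t₁ (suc t₂) {a} {b} {c} a⇝b b⇝c with ∨-true⁻ {walk F t₂ b c} b⇝c
  ... | inj₁ b⇝c′ = ∨-trueˡ _ (walk-++ t₁ t₂ a⇝b b⇝c′)
  ... | inj₂ b⇝w→c with w , _ , w-step ← anyL⁻ _ (allFin m) b⇝w→c =
    ∨-trueʳ (walk F (t₂ + t₁) a c) (anyL⁺ (λ w → walk F (t₂ + t₁) a w ∧ adj F w c) (∈-allFin w)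
      (∧-true (walk-++ t₁ t₂ a⇝b (∧-conicalˡ _ _ w-step)) (∧-conicalʳ _ _ w-step)))

  rooted : ∀ v → Σ (Fin m) λ r → Σ ℕ λ t → IsRoot r × walk F t r v ≡ true
  rooted v = rooted-below (suc (toℕ v)) v ℕ.≤-refl
    where
    rooted-below : ∀ B v → toℕ v < B → Σ (Fin m) λ r → Σ ℕ λ t → IsRoot r × walk F t r v ≡ true
    rooted-below (suc B) v v<B with isLeastInComponent F v in least
    ... | true  = v , 0 , least , ⌊⌋-true⁺ (v Fin.≟ v) refl
    ... | false with b , _ , b-earlier ← allL-false⁻ _ (allFin m) least
                with r , t , root , r⇝b ← rooted-below B b
                       (ℕ.≤-trans (⌊⌋-true⁻ (b Fin.<? v) (∧-conicalˡ _ _ (not-false⁻ b-earlier))) (ℕ.≤-pred v<B)) =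
      r , m + t , root , walk-++ t m r⇝b (∧-conicalʳ _ _ (not-false⁻ b-earlier))

  reachableWithin : Fin m → ℕ → Bool
  reachableWithin v t = anyL (λ r → isLeastInComponent F r ∧ walk F t r v) (allFin m)

  reachable⁺ : ∀ {r} v t → IsRoot r → walk F t r v ≡ true → reachableWithin v t ≡ true
  reachable⁺ {r} v t root r⇝v = anyL⁺ (λ r → isLeastInComponent F r ∧ walk F t r v) (∈-allFin r) (∧-true root r⇝v)

  reachable⁻ : ∀ v t → reachableWithin v t ≡ true → Σ (Fin m) λ r → IsRoot r × walk F t r v ≡ true
  reachable⁻ v t reachable =
    let r , _ , found = anyL⁻ (λ r → isLeastInComponent F r ∧ walk F t r v) (allFin m) reachable
    in  r , ∧-conicalˡ (isLeastInComponent F r) _ found , ∧-conicalʳ (isLeastInComponent F r) _ found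

  private
    first-level : ∀ v → Σ ℕ λ t → reachableWithin v t ≡ true × ∀ u → u < t → reachableWithin v u ≡ false
    first-level v with _ , t , root , r⇝v ← rooted v = first-true (reachableWithin v) t (reachable⁺ v t root r⇝v)

  level : Fin m → ℕ
  level v = proj₁ (first-level v)

  level-minimal : ∀ {v t} → reachableWithin v t ≡ true → level v ≤ t
  level-minimal {v} {t} reachable with level v ℕ.≤? t
  ... | yes level≤t = level≤t
  ... | no  level≰t = contradiction (trans (≡.sym reachable) (proj₂ (proj₂ (first-level v)) t (ℕ.≰⇒> level≰t))) λ ()

  RootOrParent : Fin m → Set
  RootOrParent v = IsRoot v ⊎ ∃ λ u → adj F u v ≡ true × level u < level v

  root-or-parent : ∀ v → RootOrParent v
  root-or-parent v = from-level (level v) refl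
    where
    reached : ∀ {t} → level v ≡ t → Σ (Fin m) λ r → IsRoot r × walk F t r v ≡ true
    reached refl = reachable⁻ v (level v) (proj₁ (proj₂ (first-level v)))
    from-level : ∀ t → level v ≡ t → RootOrParent v
    from-level zero level≡0 with r , root , r⇝v ← reached level≡0 with refl ← ⌊⌋-true⁻ (r Fin.≟ v) r⇝v = inj₁ root
    from-level (suc t) level≡t+1 with r , root , r⇝v ← reached level≡t+1 with ∨-true⁻ {walk F t r v} r⇝v
    ... | inj₁ r⇝v′ = contradiction (level-minimal (reachable⁺ v t root r⇝v′))
                                    (subst (λ l → ¬ l ≤ t) (≡.sym level≡t+1) (ℕ.<⇒≱ (ℕ.n<1+n t)))
    ... | inj₂ r⇝u→v with u , _ , r⇝u→v′ ← anyL⁻ (λ u → walk F t r u ∧ adj F u v) (allFin m) r⇝u→v =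
      inj₂ (u , ∧-conicalʳ (walk F t r u) _ r⇝u→v′ ,
            subst (level u <_) (≡.sym level≡t+1) (s≤s (level-minimal (reachable⁺ u t root (∧-conicalˡ (walk F t r u) _ r⇝u→v′)))))

-- Encoding embeddings

Embedding : ∀ {m n} → ℕ → Graph m → (Fin m → Fin n) → Set
Embedding k F f = (∀ a b → f a ≡ f b → a ≡ b) × (∀ a b → adj F a b ≡ true → adjH k (f a) (f b) ≡ true)

isEmbeddingᵇ-sound : ∀ {m n} k (F : Graph m) {f : Fin m → Fin n} → T (isEmbeddingᵇ k F f) → Embedding k F f
isEmbeddingᵇ-sound k F {f} t = injective , edges
  where
  pair : ∀ a b → ((⌊ a Fin.≟ b ⌋ ∨ not ⌊ f a Fin.≟ f b ⌋) ∧ (not (adj F a b) ∨ adjH k (f a) (f b))) ≡ true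
  pair a b = allL⁻ _ (allL⁻ _ (Equivalence.to T-≡ t) (∈-allFin a)) (∈-allFin b)
  injective : ∀ a b → f a ≡ f b → a ≡ b
  injective a b fa≡fb with a Fin.≟ b | f a Fin.≟ f b | pair a b
  ... | yes a≡b | _        | _  = a≡b
  ... | no  _   | yes _    | ()
  ... | no  _   | no fa≢fb | _  = contradiction fa≡fb fa≢fb
  edges : ∀ a b → adj F a b ≡ true → adjH k (f a) (f b) ≡ true
  edges a b a~b = subst (λ x → not x ∨ adjH k (f a) (f b) ≡ true) a~b (∧-conicalʳ _ _ (pair a b))

module Encoding (k n : ℕ) .{{_ : NonZero k}} .{{_ : NonZero n}} (k*k+k<n : k * k + k < n)
                {m d : ℕ} (F : Graph m) (p : Fin m → Fin d) (partition : IsPartition p) (consistent : Consistent n k F p) where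
  open Modulo n
  open CyclePower k n
  open PathPower k n k*k+k<n
  open Levels F

  record PartStructure (j : Fin d) : Set where
    field
      size           : ℕ
      size≤n         : size ≤ n
      size-nonZero   : NonZero size
      size-cases     : size ≡ 1 ⊎ 2 * k + 1 ≤ size
      copy           : Fin size → Fin m
      copy-injective : ∀ x y → copy x ≡ copy y → x ≡ y
      copy-onto      : ∀ v → p v ≡ j → ∃ λ x → copy x ≡ v
      copy-adj       : ∀ x y → adj F (copy x) (copy y) ≡ adjH k (inject≤ x size≤n) (inject≤ y size≤n)

  structure : ∀ j → PartStructure j
  structure j = from (consistent j)
    where
    nonZero : ∀ {s} → s ≡ 1 ⊎ 2 * k + 1 ≤ s → NonZero s
    nonZero (inj₁ refl)  = _
    nonZero (inj₂ large) = >-nonZero (ℕ.≤-trans (ℕ.m≤n+m 1 (2 * k)) large)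
    from : Σ ℕ (λ s → Σ (s ≤ n) λ s≤n → (s ≡ 1 ⊎ 2 * k + 1 ≤ s) × PartIsoHs n k F p j s s≤n) → PartStructure j
    from (s , s≤n , cases , g , g-injective , _ , g-onto , g-adj) = record
      { size = s ; size≤n = s≤n ; size-nonZero = nonZero cases ; size-cases = cases
      ; copy = g ; copy-injective = g-injective ; copy-onto = g-onto ; copy-adj = g-adj }

  module Part (j : Fin d) where
    open PartStructure (structure j) public

    instance
      nonZero-size : NonZero size
      nonZero-size = size-nonZero

    -- Reading indices modulo size extends the part to an ℕ-indexed sequence; only t < size matters.
    sequence : (Fin m → Fin n) → ℕ → Fin n
    sequence f t = f (copy (t mod size))

    toℕ-mod : ∀ {t} → t < size → toℕ (t mod size) ≡ t
    toℕ-mod t<size = trans (Fin.toℕ-fromℕ< _) (m<n⇒m%n≡m t<size)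

    sequence-toℕ : ∀ f x → sequence f (toℕ x) ≡ f (copy x)
    sequence-toℕ f x = cong (f ∘ copy) (Fin.toℕ-injective (toℕ-mod (Fin.toℕ<n x)))

    sequence-embeds : ∀ {f} → Embedding k F f → EmbedsPathPower size (sequence f)
    sequence-embeds {f} (f-injective , f-edges) = record
      { injective = λ {x} {y} x<y y<s fx≡fy → ℕ.<-irrefl
          (trans (≡.sym (toℕ-mod (ℕ.<-trans x<y y<s))) (trans (cong toℕ (copy-injective _ _ (f-injective _ _ fx≡fy))) (toℕ-mod y<s))) x<y
      ; adjacent = λ {x} {y} x<y y<s y≤x+k → f-edges _ _ (trans (copy-adj _ _)
          (path-adjH (subst₂ _<_ (≡.sym (index x (ℕ.<-trans x<y y<s))) (≡.sym (index y y<s)) x<y)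
                     (subst₂ (λ a b → a ≤ b + k) (≡.sym (index y y<s)) (≡.sym (index x (ℕ.<-trans x<y y<s))) y≤x+k)))
      }
      where
      index : ∀ t → t < size → toℕ (inject≤ (t mod size) size≤n) ≡ t
      index t t<size = trans (Fin.toℕ-inject≤ _ size≤n) (toℕ-mod t<size)

    rigid : ∀ {f₁ f₂} → Embedding k F f₁ → Embedding k F f₂ → orientation (sequence f₁) ≡ orientation (sequence f₂) →
            ∀ {w v} → p w ≡ j → p v ≡ j → f₁ w ≡ f₂ w → f₁ v ≡ f₂ v
    rigid {f₁} {f₂} e₁ e₂ same-orientation {w} {v} pw≡j pv≡j f₁w≡f₂w
      with x , refl ← copy-onto w pw≡j | y , refl ← copy-onto v pv≡j
      with size-cases
    ... | inj₁ size≡1 =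
      subst (λ z → f₁ z ≡ f₂ z) (cong copy (Fin.toℕ-injective (trans (below-1 x) (≡.sym (below-1 y))))) f₁w≡f₂w
      where
      below-1 : ∀ z → toℕ z ≡ 0
      below-1 z = ℕ.n<1⇒n≡0 (subst (toℕ z <_) size≡1 (Fin.toℕ<n z))
    ... | inj₂ large = begin
      f₁ (copy y)          ≡⟨ sequence-toℕ f₁ y ⟨
      sequence f₁ (toℕ y)  ≡⟨ path-power-rigid large (sequence-embeds e₁) (sequence-embeds e₂) same-orientation
                                               (Fin.toℕ<n x) same-at-x (toℕ y) (Fin.toℕ<n y) ⟩
      sequence f₂ (toℕ y)  ≡⟨ sequence-toℕ f₂ y ⟩
      f₂ (copy y)          ∎
      where
      open ≡-Reasoning
      same-at-x : sequence f₁ (toℕ x) ≡ sequence f₂ (toℕ x)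
      same-at-x = trans (sequence-toℕ f₁ x) (trans f₁w≡f₂w (≡.sym (sequence-toℕ f₂ x)))

  open Extrema ℕ.≤-totalOrder using (argmin; argmin-all; f[argmin]≤f[xs])

  members : Fin d → List (Fin m)
  members j = filter (λ v → p v Fin.≟ j) (allFin m)

  representative : Fin d → Fin m
  representative j = argmin level (proj₁ (partition j)) (members j)

  representative-in-part : ∀ j → p (representative j) ≡ j
  representative-in-part j = argmin-all level (proj₂ (partition j))
    (All.tabulate λ v∈ → proj₂ (∈-filter⁻ (λ v → p v Fin.≟ j) {xs = allFin m} v∈))

  representative-lowest : ∀ {j v} → p v ≡ j → level (representative j) ≤ level v
  representative-lowest {j} {v} pv≡j =
    All.lookup (f[argmin]≤f[xs] (proj₁ (partition j)) (members j)) (∈-filter⁺ (λ v → p v Fin.≟ j) (∈-allFin v) pv≡j)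

  -- The image of a root is recorded separately in the code; its entry +1 is only a placeholder.
  entry : (Fin m → Fin n) → ∀ v → RootOrParent v → ℤ
  entry f v (inj₁ _)       = + 1
  entry f v (inj₂ (u , _)) = offset (f u) (f v)

  roots : List (Fin m)
  roots = filter (λ a → T? (isLeastInComponent F a)) (allFin m)

  Code : Set
  Code = List (Fin n) × List (ℤ × Bool)

  label : (Fin m → Fin n) → Fin d → ℤ × Bool
  label f j = entry f (representative j) (root-or-parent (representative j)) , orientation (Part.sequence j f)

  code : (Fin m → Fin n) → Code
  code f = map f roots , map (label f) (allFin d)

  module Decoding {f₁ f₂ : Fin m → Fin n} (e₁ : Embedding k F f₁) (e₂ : Embedding k F f₂) (same-code : code f₁ ≡ code f₂) where

    same-on-roots : ∀ {r} → IsRoot r → f₁ r ≡ f₂ r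
    same-on-roots {r} root = map≡map⇒≡ f₁ f₂ (cong proj₁ same-code)
                               (∈-filter⁺ (λ a → T? (isLeastInComponent F a)) (∈-allFin r) (Equivalence.from T-≡ root))

    same-label : ∀ j → label f₁ j ≡ label f₂ j
    same-label j = map≡map⇒≡ (label f₁) (label f₂) (cong proj₂ same-code) (∈-allFin j)

    entry-determines : ∀ w (o : RootOrParent w) → entry f₁ w o ≡ entry f₂ w o →
                       (∀ u → level u < level w → f₁ u ≡ f₂ u) → f₁ w ≡ f₂ w
    entry-determines w (inj₁ root) _ _ = same-on-roots root
    entry-determines w (inj₂ (u , u~w , lower)) same-offset below = toℕ-≡ₘ-injective (begin
      + toℕ (f₁ w)                         ≈⟨ proj₂ (adjH⇒offset (proj₂ e₁ u w u~w)) ⟩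
      + toℕ (f₁ u) +ℤ offset (f₁ u) (f₁ w) ≡⟨ cong₂ (λ a z → + toℕ a +ℤ z) (below u lower) same-offset ⟩
      + toℕ (f₂ u) +ℤ offset (f₂ u) (f₂ w) ≈⟨ ≡ₘ-sym (proj₂ (adjH⇒offset (proj₂ e₂ u w u~w))) ⟩
      + toℕ (f₂ w)                         ∎)
      where open SetoidReasoning ≡ₘ-setoid

    agree-below : ∀ B v → level v < B → f₁ v ≡ f₂ v
    agree-below (suc B) v level<B = Part.rigid j e₁ e₂ (cong proj₂ (same-label j)) (representative-in-part j) refl
      (entry-determines w (root-or-parent w) (cong proj₁ (same-label j))
        λ u lower → agree-below B u (ℕ.<-≤-trans lower (ℕ.≤-trans (representative-lowest refl) (ℕ.≤-pred level<B))))
      where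
      j = p v
      w = representative j

    decode : ∀ v → f₁ v ≡ f₂ v
    decode v = agree-below (suc (level v)) v ℕ.≤-refl

  alphabet : List (ℤ × Bool)
  alphabet = cartesianProduct (offsets k) (true ∷ false ∷ [])

  length-alphabet : length alphabet ≡ 4 * k
  length-alphabet = begin
    length alphabet        ≡⟨ length-cartesianProductWith _,_ (offsets k) (true ∷ false ∷ []) ⟩
    length (offsets k) * 2 ≡⟨ cong (_* 2) (length-offsets k) ⟩
    (k + k) * 2            ≡⟨ ℕ.*-comm (k + k) 2 ⟩
    2 * (k + k)            ≡⟨ cong (λ x → 2 * (k + x)) (≡.sym (ℕ.+-identityʳ k)) ⟩
    2 * (2 * k)            ≡⟨ ℕ.*-assoc 2 2 k ⟨
    4 * k                  ∎
    where open ≡-Reasoning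

  open InjectiveLists n

  codes : List Code
  codes = cartesianProduct (injectiveLists (c F)) (words alphabet d)

  length-codes : length codes ≤ (n P′ c F) * (4 * k) ^ d
  length-codes = begin
    length codes
      ≡⟨ length-cartesianProductWith _,_ (injectiveLists (c F)) (words alphabet d) ⟩
    length (injectiveLists (c F)) * length (words alphabet d)
      ≡⟨ cong (length (injectiveLists (c F)) *_) (length-words alphabet d) ⟩
    length (injectiveLists (c F)) * length alphabet ^ d
      ≤⟨ ℕ.*-monoˡ-≤ _ (length-injectiveLists (c F)) ⟩
    (n P′ c F) * length alphabet ^ d
      ≡⟨ cong (λ a → (n P′ c F) * a ^ d) length-alphabet ⟩
    (n P′ c F) * (4 * k) ^ d
      ∎
    where open ℕ.≤-Reasoning

  label∈alphabet : ∀ {f} → Embedding k F f → ∀ j → label f j ∈ alphabet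
  label∈alphabet {f} e j = ∈-cartesianProduct⁺ (entry∈offsets (representative j) (root-or-parent (representative j))) (bool∈ _)
    where
    entry∈offsets : ∀ v o → entry f v o ∈ offsets k
    entry∈offsets v (inj₁ _)              = ∈-++⁺ˡ (∈-map⁺ (λ i → + suc i) (∈-upTo⁺ (>-nonZero⁻¹ k)))
    entry∈offsets v (inj₂ (u , u~v , _)) = proj₁ (adjH⇒offset (proj₂ e u v u~v))
    bool∈ : ∀ b → b ∈ true ∷ false ∷ []
    bool∈ true  = here refl
    bool∈ false = there (here refl)

  code∈codes : ∀ {f} → Embedding k F f → code f ∈ codes
  code∈codes {f} e = ∈-cartesianProduct⁺ roots-image labels
    where
    roots-image : map f roots ∈ injectiveLists (c F)
    roots-image = subst (λ l → map f roots ∈ injectiveLists l) (List.length-map f roots)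
      (∈-injectiveLists (map f roots)
        (Unique.map⁺ (proj₁ e _ _) (Unique.filter⁺ (λ a → T? (isLeastInComponent F a)) (Unique.allFin⁺ m))))
    labels : map (label f) (allFin d) ∈ words alphabet d
    labels = subst (λ l → map (label f) (allFin d) ∈ words alphabet l) (trans (List.length-map (label f) (allFin d)) (length-allFin d))
      (∈-words (map (label f) (allFin d)) (All.map⁺ (All.tabulate λ {j} _ → label∈alphabet e j)))

  embeddings : List (Fin m → Fin n)
  embeddings = filter (λ f → T? (isEmbeddingᵇ k F f)) (allMaps m n)

  embeddings-sound : All (Embedding k F) embeddings
  embeddings-sound = All.tabulate λ f∈ →
    isEmbeddingᵇ-sound k F (proj₂ (∈-filter⁻ (λ f → T? (isEmbeddingᵇ k F f)) {xs = allMaps m n} f∈))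

  _≟-code_ : (a b : Code) → Dec (a ≡ b)
  _≟-code_ = Product.≡-dec (List.≡-dec Fin._≟_) (List.≡-dec (Product.≡-dec ℤ._≟_ Bool._≟_))

  Y≤length-codes : Y n k F ≤ length codes
  Y≤length-codes = begin
    Y n k F                      ≡⟨ List.length-map code embeddings ⟨
    length (map code embeddings) ≤⟨ Unique⇒length≤ _≟-code_ unique images ⟩
    length codes                 ∎
    where
    open ℕ.≤-Reasoning
    unique = Unique-map⁺ code embeddings-sound (AllPairs.filter⁺ (λ f → T? (isEmbeddingᵇ k F f)) (allMaps-distinct m n))
               λ e₁ e₂ distinct same → distinct (Decoding.decode e₁ e₂ same)
    images : ∀ {x} → x ∈ map code embeddings → x ∈ codes
    images x∈ = let f , f∈ , x≡code-f = ∈-map⁻ code x∈ in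
      subst (_∈ codes) (≡.sym x≡code-f) (code∈codes (All.lookup embeddings-sound f∈))

  bound : m ≤ n → Y n k F ≤ (n P c F) * (4 * k) ^ d
  bound m≤n = begin
    Y n k F                  ≤⟨ Y≤length-codes ⟩
    length codes             ≤⟨ length-codes ⟩
    (n P′ c F) * (4 * k) ^ d ≡⟨ cong (_* (4 * k) ^ d) (nPk≡nP′k c≤n) ⟨
    (n P c F) * (4 * k) ^ d  ∎
    where
    open ℕ.≤-Reasoning
    c≤n : c F ≤ n
    c≤n = ℕ.≤-trans (List.length-filter (λ a → T? (isLeastInComponent F a)) (allFin m))
                    (ℕ.≤-trans (ℕ.≤-reflexive (length-allFin m)) m≤n)

lemma3p9 : ∀ (k : ℕ) → 4 ≤ k → ∃ λ (n₀ : ℕ) → ∀ (n : ℕ) → n₀ ≤ n →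
    ∀ {m d : ℕ} (F : Graph m) (p : Fin m → Fin d) →
      SubgraphOfH n k F → NoIsolatedVertices F → NoIsolatedEdges F →
      IsPartition p → Consistent n k F p →
      Y n k F ≤ (n P c F) * (4 * k) ^ d
lemma3p9 k@(suc _) _ = suc (k * k + k) , λ where
  n@(suc _) k*k+k<n F p (_ , F↪H , _) _ _ partition consistent →
    Encoding.bound k n k*k+k<n F p partition consistent (Fin.injective⇒≤ λ {a} {b} → F↪H a b)
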